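{- Let $c_{4}(n)$ be the number of partitions of $n$ which satisfy one of the following: (a) all parts are distinct; or (b) for some $j\ge1$, the largest repeated part is $j$, it appears exactly twice, every positive integer less than $j$ appears exactly twice, and every part greater than $j$ occurs only once. Let $c_{4,e}(n)$ (resp. $c_{4,o}(n)$) be the number of $c_4(n)$-partitions with an even (resp. odd) number of distinct parts. Then for all $n\ge 0$, $$c_{4,e}(n) - c_{4,o}(n)= \begin{cases} (-1)^{j}, & \text{if } n = (5j^2 + 3j)/2 \text{ for some } j \in \mathbb{Z},\\ 0, & \text{otherwise}.\end{cases}$$
   Context: Partitions are non-increasing finite sequences of positive integers; the empty partition counts as a partition of $0$. A "distinct part" of a partition means a part occurring exactly once in it (so in case (b) the parts $1,\dots,j$, which occur twice, are not counted). -}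

module Defs where

open import Data.Nat using (ℕ; zero; suc; _≤_; _<_; _≟_; _%_)
open import Data.Nat.Properties using ()
open import Data.Integer as ℤ using (ℤ; +_; -_; ∣_∣)
open import Data.List using (List; []; _∷_; length; filter)
open import Data.Nat.ListAction using (sum)
open import Data.List.Relation.Unary.All using (All)
open import Data.List.Relation.Unary.Linked using (Linked)
open import Data.Product using (Σ; _×_)
open import Relation.Binary.PropositionalEquality using (_≡_)

IsPartitionOf : ℕ → List ℕ → Set
IsPartitionOf n p = Linked (λ a b → b ≤ a) p × All (λ a → 1 ≤ a) p × sum p ≡ n

mult : ℕ → List ℕ → ℕ
mult x p = length (filter (λ y → y ≟ x) p)

AllDistinct : List ℕ → Set
AllDistinct p = ∀ x → mult x p ≤ 1

-- (b) for some j ≥ 1: j appears exactly twice, every i with 1 ≤ i < j appears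
-- exactly twice, every part greater than j occurs only once.
-- (Then j is the largest repeated part.)
TypeB : List ℕ → Set
TypeB p = Σ ℕ λ j → 1 ≤ j × mult j p ≡ 2
                  × (∀ i → 1 ≤ i → i < j → mult i p ≡ 2)
                  × (∀ i → j < i → mult i p ≤ 1)

data C4 (p : List ℕ) : Set where
  caseA : AllDistinct p → C4 p
  caseB : TypeB p → C4 p

-- number of distinct parts: number of parts occurring exactly once
-- (each such part appears once in the list, so counting list entries is correct)
numDistinctParts : List ℕ → ℕ
numDistinctParts p = length (filter (λ x → mult x p ≟ 1) p)

weight : List ℕ → ℤ
weight p with numDistinctParts p % 2
... | zero  = + 1
... | suc _ = - (+ 1)

signedCount : List (List ℕ) → ℤ
signedCount [] = + 0
signedCount (p ∷ ps) = weight p ℤ.+ signedCount ps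

negOnePow : ℤ → ℤ
negOnePow j = (- (+ 1)) ℤ.^ ∣ j ∣

-- Weighting a c₄-partition by (-1)^(number of distinct parts), the partition with staircase
-- 1,1,…,j,j (j = 0 in case (a)) and distinct parts μ, all > j, contributes (-1)^|μ| q^(j² + j + Σμ).
-- Hence Σₙ (c₄,ₑ(n) − c₄,ₒ(n)) qⁿ = E₀, where E_m = Σ_j q^(j² + (m+1)j) (q^(j+1); q)_∞.
-- The family E_m satisfies E_m = E_(m+1) + q^(m+2) E_(m+2), and so does
-- A_m = Σₙ (-1)ⁿ q^(n(5n+3)/2 + 2mn) (1 − q^(m+1+2n)) (q^(n+1); q)_m,
-- through the telescoping identities A_m = B_(m+1) and B_m = A_m + q^(m+1) A_(m+1) for a companion
-- family B. Both families have the coefficients of (q; q)_∞ up to degree m, so the recurrence forces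
-- E = A, and A₀ = Σ_{j ∈ ℤ} (-1)^j q^((5j² + 3j)/2).
module Submission where

open import Defs
open import Data.Nat using (ℕ)
open import Data.Integer using (ℤ; +_; _+_; _*_)
open import Data.List using (List)
open import Data.List.Membership.Propositional using (_∈_)
open import Data.List.Relation.Unary.Unique.Propositional using (Unique)
open import Data.Product using (_×_)
open import Function.Bundles using (_⇔_)
open import Relation.Binary.PropositionalEquality using (_≡_; _≢_)

open import Data.Empty using (⊥-elim)
open import Data.Integer using (-_; _-_; _^_; 0ℤ; 1ℤ; -[1+_])
import Data.Integer.Properties as ℤ
import Data.Integer.Tactic.RingSolver as ℤ-Solver
open import Data.List using ([]; _∷_; _++_; length; filter; map)
open import Data.List.Membership.Propositional.Properties using (∈-++⁺ˡ; ∈-++⁺ʳ; ∈-++⁻; ∈-map⁺; ∈-map⁻; ∈-∃++)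
import Data.List.Properties as List
open import Data.List.Relation.Binary.Permutation.Propositional as ↭ using (_↭_; ↭⇒↭ₛ)
import Data.List.Relation.Binary.Permutation.Propositional.Properties as ↭
import Data.List.Relation.Binary.Permutation.Setoid.Properties as PermutationSetoid
open import Data.List.Relation.Unary.All as All using (All; []; _∷_)
import Data.List.Relation.Unary.All.Properties as All
open import Data.List.Relation.Unary.AllPairs as AllPairs using (AllPairs; []; _∷_)
import Data.List.Relation.Unary.AllPairs.Properties as AllPairs
open import Data.List.Relation.Unary.Any using (here; there)
open import Data.List.Relation.Unary.Linked.Properties using (AllPairs⇒Linked; Linked⇒AllPairs)
import Data.List.Relation.Unary.Unique.Propositional.Properties as Unique
open import Data.Nat as ℕ using (zero; suc; _≤_; _<_; _≥_; _>_; z≤n; s≤s; _∸_; _≟_; _%_)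
open import Data.Nat.DivMod using ([m+n]%n≡m%n; m%n<n)
open import Data.Nat.Induction using (<-rec)
open import Data.Nat.ListAction using (sum)
open import Data.Nat.ListAction.Properties using (sum-++)
import Data.Nat.Properties as ℕ
import Data.Nat.Tactic.RingSolver as ℕ-Solver
open import Data.Product as Product using (Σ; _,_; proj₁; proj₂)
open import Data.Sum using (inj₁; inj₂)
open import Function using (_∘_)
open import Function.Bundles using (Equivalence)
open import Relation.Binary.Definitions using (tri<; tri≈; tri>)
import Relation.Binary.PropositionalEquality as ≡
open import Relation.Binary.PropositionalEquality using (refl; sym; trans; cong; cong₂; subst; _≗_; module ≡-Reasoning)
open import Relation.Nullary using (yes; no; ¬_)

Series : Set
Series = ℕ → ℤ

1ₛ : Series
1ₛ zero = 1ℤ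
1ₛ (suc n) = 0ℤ

infixr 6 q^_·_ [1-q^_]·_

q^_·_ : ℕ → Series → Series
(q^ zero · f) n = f n
(q^ suc e · f) zero = 0ℤ
(q^ suc e · f) (suc n) = (q^ e · f) n

[1-q^_]·_ : ℕ → Series → Series
([1-q^ k ]· f) n = f n - (q^ k · f) n

qPoch : ℕ → ℕ → Series
qPoch k zero = 1ₛ
qPoch k (suc b) = [1-q^ k ℕ.+ b ]· qPoch k b

-- The coefficient of q^n stabilises once k + b > n, which defines (q^k; q)_∞.
qPoch∞ : ℕ → Series
qPoch∞ k n = qPoch k (suc n) n

shift-below : ∀ e f {n} → n < e → (q^ e · f) n ≡ 0ℤ
shift-below (suc e) f {zero} _ = refl
shift-below (suc e) f {suc n} (s≤s n<e) = shift-below e f n<e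

shift-above : ∀ e f {n} → e ≤ n → (q^ e · f) n ≡ f (n ∸ e)
shift-above zero f _ = refl
shift-above (suc e) f {suc n} (s≤s e≤n) = shift-above e f e≤n

shift-cong : ∀ e {f g} → f ≗ g → q^ e · f ≗ q^ e · g
shift-cong zero f≗g n = f≗g n
shift-cong (suc e) f≗g zero = refl
shift-cong (suc e) f≗g (suc n) = shift-cong e f≗g n

shift-shift : ∀ e k f → q^ e · q^ k · f ≗ q^ (e ℕ.+ k) · f
shift-shift zero k f n = refl
shift-shift (suc e) k f zero = refl
shift-shift (suc e) k f (suc n) = shift-shift e k f n

shift-0ℤ : ∀ e → q^ e · (λ _ → 0ℤ) ≗ (λ _ → 0ℤ)
shift-0ℤ zero n = refl
shift-0ℤ (suc e) zero = refl
shift-0ℤ (suc e) (suc n) = shift-0ℤ e n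

shift-scale : ∀ e s f → q^ e · (λ i → s * f i) ≗ (λ i → s * (q^ e · f) i)
shift-scale zero s f n = refl
shift-scale (suc e) s f zero = sym (ℤ.*-zeroʳ s)
shift-scale (suc e) s f (suc n) = shift-scale e s f n

shift-[1-q^] : ∀ e k f → q^ e · [1-q^ k ]· f ≗ (λ n → (q^ e · f) n - (q^ (e ℕ.+ k) · f) n)
shift-[1-q^] zero k f n = refl
shift-[1-q^] (suc e) k f zero = refl
shift-[1-q^] (suc e) k f (suc n) = shift-[1-q^] e k f n

shift-[1-q^]-[1-q^] : ∀ e k d f → q^ e · [1-q^ k ]· [1-q^ d ]· f ≗
  (λ n → ((q^ e · f) n - (q^ (e ℕ.+ d) · f) n) - ((q^ (e ℕ.+ k) · f) n - (q^ (e ℕ.+ k ℕ.+ d) · f) n))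
shift-[1-q^]-[1-q^] e k d f n =
  trans (shift-[1-q^] e k ([1-q^ d ]· f) n) (cong₂ _-_ (shift-[1-q^] e d f n) (shift-[1-q^] (e ℕ.+ k) d f n))

[1-q^]-cong : ∀ k {f g} → f ≗ g → [1-q^ k ]· f ≗ [1-q^ k ]· g
[1-q^]-cong k f≗g n = cong₂ _-_ (f≗g n) (shift-cong k f≗g n)

[1-q^]-comm : ∀ a b f → [1-q^ a ]· [1-q^ b ]· f ≗ [1-q^ b ]· [1-q^ a ]· f
[1-q^]-comm a b f n
  rewrite shift-[1-q^] a b f n | shift-[1-q^] b a f n | ℕ.+-comm a b
  = exchange (f n) ((q^ b · f) n) ((q^ a · f) n) ((q^ (b ℕ.+ a) · f) n)
  where
  exchange : ∀ x y z w → x - y - (z - w) ≡ x - z - (y - w)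
  exchange = ℤ-Solver.solve-∀

[1-q^0]-annihilates : ∀ f → [1-q^ 0 ]· f ≗ (λ _ → 0ℤ)
[1-q^0]-annihilates f n = ℤ.+-inverseʳ (f n)

qPoch-suc : ∀ k b → qPoch k (suc b) ≗ [1-q^ k ]· qPoch (suc k) b
qPoch-suc k zero n rewrite ℕ.+-identityʳ k = refl
qPoch-suc k (suc b) n = begin
  ([1-q^ k ℕ.+ suc b ]· qPoch k (suc b)) n
    ≡⟨ [1-q^]-cong (k ℕ.+ suc b) (qPoch-suc k b) n ⟩
  ([1-q^ k ℕ.+ suc b ]· [1-q^ k ]· qPoch (suc k) b) n
    ≡⟨ [1-q^]-comm (k ℕ.+ suc b) k (qPoch (suc k) b) n ⟩
  ([1-q^ k ]· [1-q^ k ℕ.+ suc b ]· qPoch (suc k) b) n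
    ≡⟨ cong (λ e → ([1-q^ k ]· [1-q^ e ]· qPoch (suc k) b) n) (ℕ.+-suc k b) ⟩
  ([1-q^ k ]· qPoch (suc k) (suc b)) n
    ∎
  where open ≡-Reasoning

qPoch0-vanishes : ∀ b → qPoch 0 (suc b) ≗ (λ _ → 0ℤ)
qPoch0-vanishes b n = trans (qPoch-suc 0 b n) ([1-q^0]-annihilates (qPoch 1 b) n)

qPoch-stable : ∀ k b d {n} → n < k ℕ.+ b → qPoch k (b ℕ.+ d) n ≡ qPoch k b n
qPoch-stable k b zero n<k+b rewrite ℕ.+-identityʳ b = refl
qPoch-stable k b (suc d) {n} n<k+b rewrite ℕ.+-suc b d
  | shift-below (k ℕ.+ (b ℕ.+ d)) (qPoch k (b ℕ.+ d)) (ℕ.<-≤-trans n<k+b (ℕ.+-monoʳ-≤ k (ℕ.m≤m+n b d)))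
  = trans (ℤ.+-identityʳ _) (qPoch-stable k b d n<k+b)

qPoch≡qPoch∞ : ∀ k b {n} → n < k ℕ.+ b → qPoch k b n ≡ qPoch∞ k n
qPoch≡qPoch∞ k b {n} n<k+b = begin
  qPoch k b n                 ≡⟨ qPoch-stable k b (suc n) n<k+b ⟨
  qPoch k (b ℕ.+ suc n) n     ≡⟨ cong (λ c → qPoch k c n) (ℕ.+-comm b (suc n)) ⟩
  qPoch k (suc n ℕ.+ b) n     ≡⟨ qPoch-stable k (suc n) b (ℕ.m≤n+m (suc n) k) ⟩
  qPoch k (suc n) n           ∎
  where open ≡-Reasoning

qPoch∞-suc : ∀ k → qPoch∞ k ≗ [1-q^ k ]· qPoch∞ (suc k)
qPoch∞-suc k n = begin
  qPoch k (suc n) n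
    ≡⟨ qPoch-suc k n n ⟩
  qPoch (suc k) n n - (q^ k · qPoch (suc k) n) n
    ≡⟨ cong₂ _-_ (qPoch≡qPoch∞ (suc k) n (ℕ.m<n+m n (s≤s z≤n))) tail ⟩
  qPoch∞ (suc k) n - (q^ k · qPoch∞ (suc k)) n
    ∎
  where
  open ≡-Reasoning
  tail : (q^ k · qPoch (suc k) n) n ≡ (q^ k · qPoch∞ (suc k)) n
  tail with k ℕ.≤? n
  ... | yes k≤n rewrite shift-above k (qPoch (suc k) n) k≤n | shift-above k (qPoch∞ (suc k)) k≤n
    = qPoch≡qPoch∞ (suc k) n (s≤s (ℕ.≤-trans (ℕ.m∸n≤m n k) (ℕ.m≤n+m n k)))
  ... | no k≰n rewrite shift-below k (qPoch (suc k) n) (ℕ.≰⇒> k≰n) | shift-below k (qPoch∞ (suc k)) (ℕ.≰⇒> k≰n)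
    = refl

∑< : ℕ → (ℕ → ℤ) → ℤ
∑< zero g = 0ℤ
∑< (suc K) g = ∑< K g + g K

syntax ∑< K (λ i → t) = ∑[ i < K ] t

∑-cong : ∀ K {g h} → (∀ i → i < K → g i ≡ h i) → ∑< K g ≡ ∑< K h
∑-cong zero g≡h = refl
∑-cong (suc K) g≡h = cong₂ _+_ (∑-cong K (λ i i<K → g≡h i (ℕ.m<n⇒m<1+n i<K))) (g≡h K ℕ.≤-refl)

∑-zero : ∀ K {g} → (∀ i → g i ≡ 0ℤ) → ∑< K g ≡ 0ℤ
∑-zero zero g≡0 = refl
∑-zero (suc K) g≡0 rewrite ∑-zero K g≡0 | g≡0 K = refl

∑-- : ∀ K (g h : ℕ → ℤ) → ∑[ i < K ] (g i - h i) ≡ ∑< K g - ∑< K h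
∑-- zero g h = refl
∑-- (suc K) g h rewrite ∑-- K g h = interchange (∑< K g) (∑< K h) (g K) (h K)
  where
  interchange : ∀ a b c d → a - b + (c - d) ≡ a + c - (b + d)
  interchange = ℤ-Solver.solve-∀

∑-telescope : ∀ K (u : ℕ → ℤ) → ∑[ i < K ] (u i - u (suc i)) ≡ u 0 - u K
∑-telescope zero u = sym (ℤ.+-inverseʳ (u 0))
∑-telescope (suc K) u rewrite ∑-telescope K u = cancel (u 0) (u K) (u (suc K))
  where
  cancel : ∀ a b c → a - b + (b - c) ≡ a - c
  cancel = ℤ-Solver.solve-∀

∑-head : ∀ K g → ∑< (suc K) g ≡ g 0 + ∑[ i < K ] g (suc i)
∑-head zero g = ℤ.+-comm 0ℤ (g 0)
∑-head (suc K) g rewrite ∑-head K g = ℤ.+-assoc (g 0) _ _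

∑-extend : ∀ K d g → (∀ i → K ≤ i → g i ≡ 0ℤ) → ∑< (K ℕ.+ d) g ≡ ∑< K g
∑-extend K zero g tail≡0 rewrite ℕ.+-identityʳ K = refl
∑-extend K (suc d) g tail≡0
  rewrite ℕ.+-suc K d | ∑-extend K d g tail≡0 | tail≡0 (K ℕ.+ d) (ℕ.m≤m+n K d)
  = ℤ.+-identityʳ _

∑-single : ∀ K g {i₀} → i₀ < K → (∀ i → i ≢ i₀ → g i ≡ 0ℤ) → ∑< K g ≡ g i₀
∑-single (suc K) g {i₀} i₀≤K others≡0 with i₀ ≟ K
... | yes refl rewrite ∑-cong K (λ i i<K → others≡0 i (λ i≡K → ℕ.<-irrefl i≡K i<K)) | ∑-zero K {λ _ → 0ℤ} (λ _ → refl)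
  = ℤ.+-identityˡ _
... | no i₀≢K rewrite ∑-single K g (ℕ.≤∧≢⇒< (ℕ.≤-pred i₀≤K) i₀≢K) others≡0 | others≡0 K (i₀≢K ∘ sym)
  = ℤ.+-identityʳ _

-- Σᵢ f i, for families with f i = O(q^i): the coefficient of q^N only involves i ≤ N.
∑ₛ : (ℕ → Series) → Series
∑ₛ f N = ∑[ i < suc N ] f i N

Summable : (ℕ → Series) → Set
Summable f = ∀ i {N} → N < i → f i N ≡ 0ℤ

∑ₛ-truncate : ∀ f → Summable f → ∀ {N K} → N < K → ∑[ i < K ] f i N ≡ ∑ₛ f N
∑ₛ-truncate f f-summable {N} N<K with ℕ.m≤n⇒∃[o]m+o≡n N<K
... | d , refl = ∑-extend (suc N) d (λ i → f i N) (λ i N<i → f-summable i N<i)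

shift-∑ₛ : ∀ f → Summable f → ∀ e K {N} → N < K ℕ.+ e → ∑[ i < K ] (q^ e · f i) N ≡ (q^ e · ∑ₛ f) N
shift-∑ₛ f f-summable e K {N} N<K+e with e ℕ.≤? N
... | yes e≤N = begin
  ∑[ i < K ] (q^ e · f i) N       ≡⟨ ∑-cong K (λ i _ → shift-above e (f i) e≤N) ⟩
  ∑[ i < K ] f i (N ∸ e)          ≡⟨ ∑ₛ-truncate f f-summable (ℕ.<-≤-trans (ℕ.∸-monoˡ-< N<K+e e≤N) (ℕ.≤-reflexive (ℕ.m+n∸n≡m K e))) ⟩
  ∑ₛ f (N ∸ e)                    ≡⟨ shift-above e (∑ₛ f) e≤N ⟨
  (q^ e · ∑ₛ f) N                 ∎
  where open ≡-Reasoning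
... | no e≰N = trans (∑-zero K (λ i → shift-below e (f i) (ℕ.≰⇒> e≰N)))
                     (sym (shift-below e (∑ₛ f) (ℕ.≰⇒> e≰N)))

-- α n = n(5n+3)/2 and β n = n(5n+1)/2.
α β : ℕ → ℕ
α zero = 0
α (suc n) = α n ℕ.+ (5 ℕ.* n ℕ.+ 4)
β zero = 0
β (suc n) = β n ℕ.+ (5 ℕ.* n ℕ.+ 3)

α≡β+n : ∀ n → α n ≡ β n ℕ.+ n
α≡β+n zero = refl
α≡β+n (suc n) rewrite α≡β+n n = step (β n) n
  where
  step : ∀ b n → b ℕ.+ n ℕ.+ (5 ℕ.* n ℕ.+ 4) ≡ b ℕ.+ (5 ℕ.* n ℕ.+ 3) ℕ.+ suc n
  step = ℕ-Solver.solve-∀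

n≤β : ∀ n → n ≤ β n
n≤β zero = z≤n
n≤β (suc n) = ℕ.≤-trans (ℕ.≤-trans (ℕ.m≤m+n (suc n) (4 ℕ.* n ℕ.+ 2)) (ℕ.≤-reflexive (step n))) (ℕ.m≤n+m _ (β n))
  where
  step : ∀ n → suc n ℕ.+ (4 ℕ.* n ℕ.+ 2) ≡ 5 ℕ.* n ℕ.+ 3
  step = ℕ-Solver.solve-∀

n≤α : ∀ n → n ≤ α n
n≤α n rewrite α≡β+n n = ℕ.m≤n+m n (β n)

-1^_ : ℕ → ℤ
-1^ n = (- 1ℤ) ^ n

aTerm bTerm aTelescoper bTelescoper : ℕ → ℕ → Series
aTerm m n N = -1^ n * (q^ (α n ℕ.+ 2 ℕ.* m ℕ.* n) · [1-q^ m ℕ.+ 1 ℕ.+ 2 ℕ.* n ]· qPoch (suc n) m) N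
bTerm m n N = -1^ n * (q^ (β n ℕ.+ 2 ℕ.* m ℕ.* n) · [1-q^ 2 ℕ.* m ℕ.+ 2 ℕ.+ 4 ℕ.* n ]· qPoch (suc n) m) N
aTelescoper m n N = -1^ n * (q^ (α n ℕ.+ 2 ℕ.* m ℕ.* n) · qPoch n (suc m)) N
bTelescoper m n N = -1^ n * (q^ (β n ℕ.+ 2 ℕ.* m ℕ.* n) · qPoch n (suc m)) N

A B : ℕ → Series
A m = ∑ₛ (aTerm m)
B m = ∑ₛ (bTerm m)

signed-shift-below : ∀ s e f {N} → N < e → s * (q^ e · f) N ≡ 0ℤ
signed-shift-below s e f N<e rewrite shift-below e f N<e = ℤ.*-zeroʳ s

aTerm-summable : ∀ m → Summable (aTerm m)
aTerm-summable m n N<n = signed-shift-below (-1^ n) _ _ (ℕ.<-≤-trans N<n (ℕ.≤-trans (n≤α n) (ℕ.m≤m+n _ _)))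

-- Each term is ± a sum of shifts y e = (q^ e · (q^(n+1); q)_m) N, so both identities come down to matching exponents.
aTerm-bTerm-telescope : ∀ m n N →
  aTerm m n N - bTerm (suc m) n N ≡ aTelescoper m n N - aTelescoper m (suc n) N
aTerm-bTerm-telescope m n N =
  trans (cong₂ _-_ aTerm≡ bTerm≡)
    (trans (regroup s (y a) (y (b ℕ.+ d)) (y b) (y a′) (y (a′ ℕ.+ d)))
      (sym (cong₂ _-_ aTelescoper≡ aTelescoper-suc≡)))
  where
  s = -1^ n
  Y = qPoch (suc n) m
  y : ℕ → ℤ
  y e = (q^ e · Y) N
  a = α n ℕ.+ 2 ℕ.* m ℕ.* n
  b = β n ℕ.+ 2 ℕ.* suc m ℕ.* n
  a′ = α (suc n) ℕ.+ 2 ℕ.* m ℕ.* suc n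
  d = suc n ℕ.+ m
  k = m ℕ.+ 1 ℕ.+ 2 ℕ.* n
  k′ = 2 ℕ.* suc m ℕ.+ 2 ℕ.+ 4 ℕ.* n
  a+k≡b+d : a ℕ.+ k ≡ b ℕ.+ d
  a+k≡b+d rewrite α≡β+n n = arith (β n) n m
    where
    arith : ∀ b n m → b ℕ.+ n ℕ.+ 2 ℕ.* m ℕ.* n ℕ.+ (m ℕ.+ 1 ℕ.+ 2 ℕ.* n) ≡ b ℕ.+ 2 ℕ.* suc m ℕ.* n ℕ.+ (suc n ℕ.+ m)
    arith = ℕ-Solver.solve-∀
  a+n≡b : a ℕ.+ n ≡ b
  a+n≡b rewrite α≡β+n n = arith (β n) n m
    where
    arith : ∀ b n m → b ℕ.+ n ℕ.+ 2 ℕ.* m ℕ.* n ℕ.+ n ≡ b ℕ.+ 2 ℕ.* suc m ℕ.* n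
    arith = ℕ-Solver.solve-∀
  b+k′≡a′ : b ℕ.+ k′ ≡ a′
  b+k′≡a′ rewrite α≡β+n n = arith (β n) n m
    where
    arith : ∀ b n m → b ℕ.+ 2 ℕ.* suc m ℕ.* n ℕ.+ (2 ℕ.* suc m ℕ.+ 2 ℕ.+ 4 ℕ.* n) ≡ b ℕ.+ n ℕ.+ (5 ℕ.* n ℕ.+ 4) ℕ.+ 2 ℕ.* m ℕ.* suc n
    arith = ℕ-Solver.solve-∀
  aTerm≡ : aTerm m n N ≡ s * (y a - y (b ℕ.+ d))
  aTerm≡ = cong (s *_) (trans (shift-[1-q^] a k Y N) (cong (λ e → y a - y e) a+k≡b+d))
  bTerm≡ : bTerm (suc m) n N ≡ s * ((y b - y (b ℕ.+ d)) - (y a′ - y (a′ ℕ.+ d)))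
  bTerm≡ = cong (s *_) (trans (shift-[1-q^]-[1-q^] b k′ d Y N) (cong (λ e → y b - y (b ℕ.+ d) - (y e - y (e ℕ.+ d))) b+k′≡a′))
  aTelescoper≡ : aTelescoper m n N ≡ s * (y a - y b)
  aTelescoper≡ = cong (s *_) (trans (shift-cong a (qPoch-suc n m) N)
                   (trans (shift-[1-q^] a n Y N) (cong (λ e → y a - y e) a+n≡b)))
  aTelescoper-suc≡ : aTelescoper m (suc n) N ≡ (- 1ℤ * s) * (y a′ - y (a′ ℕ.+ d))
  aTelescoper-suc≡ = cong ((- 1ℤ * s) *_) (shift-[1-q^] a′ d Y N)
  regroup : ∀ s y₁ y₂ y₃ y₄ y₅ → s * (y₁ - y₂) - s * ((y₃ - y₂) - (y₄ - y₅)) ≡ s * (y₁ - y₃) - (- 1ℤ * s) * (y₄ - y₅)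
  regroup = ℤ-Solver.solve-∀

bTerm-aTerm-telescope : ∀ m n N →
  bTerm m n N - aTerm m n N - (q^ suc m · aTerm (suc m) n) N ≡ bTelescoper m n N - bTelescoper m (suc n) N
bTerm-aTerm-telescope m n N =
  trans (cong₂ _-_ (cong₂ _-_ bTerm≡ aTerm≡) shifted-aTerm≡)
    (trans (regroup s (y b) (y (p ℕ.+ d)) (y a) (y p) (y b′) (y (b′ ℕ.+ d)))
      (sym (cong₂ _-_ bTelescoper≡ bTelescoper-suc≡)))
  where
  s = -1^ n
  Y = qPoch (suc n) m
  y : ℕ → ℤ
  y e = (q^ e · Y) N
  a = α n ℕ.+ 2 ℕ.* m ℕ.* n
  b = β n ℕ.+ 2 ℕ.* m ℕ.* n
  a₊ = α n ℕ.+ 2 ℕ.* suc m ℕ.* n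
  p = suc m ℕ.+ a₊
  b′ = β (suc n) ℕ.+ 2 ℕ.* m ℕ.* suc n
  d = suc n ℕ.+ m
  k = m ℕ.+ 1 ℕ.+ 2 ℕ.* n
  k′ = 2 ℕ.* m ℕ.+ 2 ℕ.+ 4 ℕ.* n
  k₊ = suc m ℕ.+ 1 ℕ.+ 2 ℕ.* n
  b+k′≡p+d : b ℕ.+ k′ ≡ p ℕ.+ d
  b+k′≡p+d rewrite α≡β+n n = arith (β n) n m
    where
    arith : ∀ b n m → b ℕ.+ 2 ℕ.* m ℕ.* n ℕ.+ (2 ℕ.* m ℕ.+ 2 ℕ.+ 4 ℕ.* n) ≡ suc m ℕ.+ (b ℕ.+ n ℕ.+ 2 ℕ.* suc m ℕ.* n) ℕ.+ (suc n ℕ.+ m)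
    arith = ℕ-Solver.solve-∀
  b+n≡a : b ℕ.+ n ≡ a
  b+n≡a rewrite α≡β+n n = arith (β n) n m
    where
    arith : ∀ b n m → b ℕ.+ 2 ℕ.* m ℕ.* n ℕ.+ n ≡ b ℕ.+ n ℕ.+ 2 ℕ.* m ℕ.* n
    arith = ℕ-Solver.solve-∀
  a+k≡p : a ℕ.+ k ≡ p
  a+k≡p rewrite α≡β+n n = arith (β n) n m
    where
    arith : ∀ b n m → b ℕ.+ n ℕ.+ 2 ℕ.* m ℕ.* n ℕ.+ (m ℕ.+ 1 ℕ.+ 2 ℕ.* n) ≡ suc m ℕ.+ (b ℕ.+ n ℕ.+ 2 ℕ.* suc m ℕ.* n)
    arith = ℕ-Solver.solve-∀
  p+k₊≡b′ : p ℕ.+ k₊ ≡ b′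
  p+k₊≡b′ rewrite α≡β+n n = arith (β n) n m
    where
    arith : ∀ b n m → suc m ℕ.+ (b ℕ.+ n ℕ.+ 2 ℕ.* suc m ℕ.* n) ℕ.+ (suc m ℕ.+ 1 ℕ.+ 2 ℕ.* n) ≡ b ℕ.+ (5 ℕ.* n ℕ.+ 3) ℕ.+ 2 ℕ.* m ℕ.* suc n
    arith = ℕ-Solver.solve-∀
  bTerm≡ : bTerm m n N ≡ s * (y b - y (p ℕ.+ d))
  bTerm≡ = cong (s *_) (trans (shift-[1-q^] b k′ Y N) (cong (λ e → y b - y e) b+k′≡p+d))
  aTerm≡ : aTerm m n N ≡ s * (y a - y p)
  aTerm≡ = cong (s *_) (trans (shift-[1-q^] a k Y N) (cong (λ e → y a - y e) a+k≡p))
  shifted-aTerm≡ : (q^ suc m · aTerm (suc m) n) N ≡ s * ((y p - y (p ℕ.+ d)) - (y b′ - y (b′ ℕ.+ d)))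
  shifted-aTerm≡ =
    trans (shift-scale (suc m) s (q^ a₊ · [1-q^ k₊ ]· [1-q^ d ]· Y) N)
      (cong (s *_) (trans (shift-shift (suc m) a₊ ([1-q^ k₊ ]· [1-q^ d ]· Y) N)
        (trans (shift-[1-q^]-[1-q^] p k₊ d Y N) (cong (λ e → y p - y (p ℕ.+ d) - (y e - y (e ℕ.+ d))) p+k₊≡b′))))
  bTelescoper≡ : bTelescoper m n N ≡ s * (y b - y a)
  bTelescoper≡ = cong (s *_) (trans (shift-cong b (qPoch-suc n m) N)
                   (trans (shift-[1-q^] b n Y N) (cong (λ e → y b - y e) b+n≡a)))
  bTelescoper-suc≡ : bTelescoper m (suc n) N ≡ (- 1ℤ * s) * (y b′ - y (b′ ℕ.+ d))
  bTelescoper-suc≡ = cong ((- 1ℤ * s) *_) (shift-[1-q^] b′ d Y N)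
  regroup : ∀ s z₁ z₂ z₃ z₄ z₅ z₆ → s * (z₁ - z₂) - s * (z₃ - z₄) - s * ((z₄ - z₂) - (z₅ - z₆)) ≡ s * (z₁ - z₃) - (- 1ℤ * s) * (z₅ - z₆)
  regroup = ℤ-Solver.solve-∀

∑-telescope-vanishing : ∀ K (u : ℕ → ℤ) → u 0 ≡ 0ℤ → u K ≡ 0ℤ → ∑[ i < K ] (u i - u (suc i)) ≡ 0ℤ
∑-telescope-vanishing K u u₀≡0 uK≡0 rewrite ∑-telescope K u | u₀≡0 | uK≡0 = refl

aTelescoper-zero : ∀ m N → aTelescoper m 0 N ≡ 0ℤ
aTelescoper-zero m N = cong (1ℤ *_) (trans (shift-cong (2 ℕ.* m ℕ.* 0) (qPoch0-vanishes m) N) (shift-0ℤ (2 ℕ.* m ℕ.* 0) N))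

bTelescoper-zero : ∀ m N → bTelescoper m 0 N ≡ 0ℤ
bTelescoper-zero m N = cong (1ℤ *_) (trans (shift-cong (2 ℕ.* m ℕ.* 0) (qPoch0-vanishes m) N) (shift-0ℤ (2 ℕ.* m ℕ.* 0) N))

aTelescoper-beyond : ∀ m N → aTelescoper m (suc N) N ≡ 0ℤ
aTelescoper-beyond m N = signed-shift-below (-1^ suc N) _ _ (ℕ.≤-trans (n≤α (suc N)) (ℕ.m≤m+n _ _))

bTelescoper-beyond : ∀ m N → bTelescoper m (suc N) N ≡ 0ℤ
bTelescoper-beyond m N = signed-shift-below (-1^ suc N) _ _ (ℕ.≤-trans (n≤β (suc N)) (ℕ.m≤m+n _ _))

A≗B-suc : ∀ m → A m ≗ B (suc m)
A≗B-suc m N = ℤ.i-j≡0⇒i≡j _ _ (begin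
  A m N - B (suc m) N
    ≡⟨ ∑-- (suc N) (λ n → aTerm m n N) (λ n → bTerm (suc m) n N) ⟨
  ∑[ n < suc N ] (aTerm m n N - bTerm (suc m) n N)
    ≡⟨ ∑-cong (suc N) (λ n _ → aTerm-bTerm-telescope m n N) ⟩
  ∑[ n < suc N ] (aTelescoper m n N - aTelescoper m (suc n) N)
    ≡⟨ ∑-telescope-vanishing (suc N) (λ n → aTelescoper m n N) (aTelescoper-zero m N) (aTelescoper-beyond m N) ⟩
  0ℤ ∎)
  where open ≡-Reasoning

B≗A+shiftA : ∀ m N → B m N ≡ A m N + (q^ suc m · A (suc m)) N
B≗A+shiftA m N = ℤ.i-j≡0⇒i≡j _ _ (begin
  B m N - (A m N + (q^ suc m · A (suc m)) N)
    ≡⟨ sub-sum (B m N) (A m N) _ ⟩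
  B m N - A m N - (q^ suc m · A (suc m)) N
    ≡⟨ cong (λ t → B m N - A m N - t) (shift-∑ₛ (aTerm (suc m)) (aTerm-summable (suc m)) (suc m) (suc N) {N} (ℕ.m≤m+n (suc N) (suc m))) ⟨
  B m N - A m N - ∑[ n < suc N ] (q^ suc m · aTerm (suc m) n) N
    ≡⟨ cong (_- ∑[ n < suc N ] (q^ suc m · aTerm (suc m) n) N) (∑-- (suc N) (λ n → bTerm m n N) (λ n → aTerm m n N)) ⟨
  ∑[ n < suc N ] (bTerm m n N - aTerm m n N) - ∑[ n < suc N ] (q^ suc m · aTerm (suc m) n) N
    ≡⟨ ∑-- (suc N) (λ n → bTerm m n N - aTerm m n N) (λ n → (q^ suc m · aTerm (suc m) n) N) ⟨
  ∑[ n < suc N ] (bTerm m n N - aTerm m n N - (q^ suc m · aTerm (suc m) n) N)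
    ≡⟨ ∑-cong (suc N) (λ n _ → bTerm-aTerm-telescope m n N) ⟩
  ∑[ n < suc N ] (bTelescoper m n N - bTelescoper m (suc n) N)
    ≡⟨ ∑-telescope-vanishing (suc N) (λ n → bTelescoper m n N) (bTelescoper-zero m N) (bTelescoper-beyond m N) ⟩
  0ℤ ∎)
  where
  open ≡-Reasoning
  sub-sum : ∀ x y z → x - (y + z) ≡ x - y - z
  sub-sum = ℤ-Solver.solve-∀

Recurrence : (ℕ → Series) → Set
Recurrence F = ∀ m N → F m N ≡ F (suc m) N + (q^ suc (suc m) · F (suc (suc m))) N

A-recurrence : Recurrence A
A-recurrence m N = trans (A≗B-suc m N) (B≗A+shiftA (suc m) N)

recurrence-unique : ∀ {F G} → Recurrence F → Recurrence G →
  (∀ m {N} → N ≤ m → F m N ≡ G m N) → ∀ m → F m ≗ G m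
recurrence-unique {F} {G} F-rec G-rec initial m N = <-rec (λ N → ∀ m → F m N ≡ G m N) step N m
  where
  step : ∀ N → (∀ {N′} → N′ < N → ∀ m → F m N′ ≡ G m N′) → ∀ m → F m N ≡ G m N
  step N below m = go N (ℕ.m≤m+n N m)
    where
    tail : ∀ m → (q^ suc (suc m) · F (suc (suc m))) N ≡ (q^ suc (suc m) · G (suc (suc m))) N
    tail m with suc (suc m) ℕ.≤? N
    ... | yes e≤N rewrite shift-above (suc (suc m)) (F (suc (suc m))) e≤N | shift-above (suc (suc m)) (G (suc (suc m))) e≤N
      = below (ℕ.∸-monoʳ-< {N} {suc (suc m)} {0} (s≤s z≤n) e≤N) (suc (suc m))
    ... | no e≰N rewrite shift-below (suc (suc m)) (F (suc (suc m))) (ℕ.≰⇒> e≰N) | shift-below (suc (suc m)) (G (suc (suc m))) (ℕ.≰⇒> e≰N)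
      = refl
    go : ∀ k {m} → N ≤ k ℕ.+ m → F m N ≡ G m N
    go zero N≤m = initial _ N≤m
    go (suc k) {m} N≤k+m rewrite F-rec m N | G-rec m N
      = cong₂ _+_ (go k (ℕ.≤-trans N≤k+m (ℕ.≤-reflexive (sym (ℕ.+-suc k m))))) (tail m)

eTerm : ℕ → ℕ → Series
eTerm m j = q^ (j ℕ.* j ℕ.+ suc m ℕ.* j) · qPoch∞ (suc j)

E : ℕ → Series
E m = ∑ₛ (eTerm m)

eTerm-summable : ∀ m → Summable (eTerm m)
eTerm-summable m j N<j = shift-below _ _ (ℕ.<-≤-trans N<j (ℕ.≤-trans (ℕ.m≤m+n j (m ℕ.* j)) (ℕ.m≤n+m _ (j ℕ.* j))))

eTerm-difference : ∀ m j → (λ N → eTerm m j N - eTerm (suc m) j N) ≗ q^ (j ℕ.* j ℕ.+ suc m ℕ.* j) · [1-q^ j ]· qPoch∞ (suc j)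
eTerm-difference m j N =
  trans (cong (λ e → eTerm m j N - (q^ e · qPoch∞ (suc j)) N) (arith j m))
        (sym (shift-[1-q^] (j ℕ.* j ℕ.+ suc m ℕ.* j) j (qPoch∞ (suc j)) N))
  where
  arith : ∀ j m → j ℕ.* j ℕ.+ suc (suc m) ℕ.* j ≡ j ℕ.* j ℕ.+ suc m ℕ.* j ℕ.+ j
  arith = ℕ-Solver.solve-∀

eTerm-difference-zero : ∀ m N → eTerm m 0 N - eTerm (suc m) 0 N ≡ 0ℤ
eTerm-difference-zero m N =
  trans (eTerm-difference m 0 N) (trans (shift-cong (suc m ℕ.* 0) ([1-q^0]-annihilates (qPoch∞ 1)) N) (shift-0ℤ (suc m ℕ.* 0) N))

eTerm-difference-suc : ∀ m i N → eTerm m (suc i) N - eTerm (suc m) (suc i) N ≡ (q^ suc (suc m) · eTerm (suc (suc m)) i) N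
eTerm-difference-suc m i N =
  trans (eTerm-difference m (suc i) N)
    (trans (shift-cong (suc i ℕ.* suc i ℕ.+ suc m ℕ.* suc i) (λ n → sym (qPoch∞-suc (suc i) n)) N)
      (trans (cong (λ e → (q^ e · qPoch∞ (suc i)) N) (arith i m))
        (sym (shift-shift (suc (suc m)) (i ℕ.* i ℕ.+ suc (suc (suc m)) ℕ.* i) (qPoch∞ (suc i)) N))))
  where
  arith : ∀ i m → suc i ℕ.* suc i ℕ.+ suc m ℕ.* suc i ≡ suc (suc m) ℕ.+ (i ℕ.* i ℕ.+ suc (suc (suc m)) ℕ.* i)
  arith = ℕ-Solver.solve-∀

E-recurrence : Recurrence E
E-recurrence m N = move (begin
  E m N - E (suc m) N
    ≡⟨ ∑-- (suc N) (λ j → eTerm m j N) (λ j → eTerm (suc m) j N) ⟨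
  ∑[ j < suc N ] (eTerm m j N - eTerm (suc m) j N)
    ≡⟨ ∑-head N (λ j → eTerm m j N - eTerm (suc m) j N) ⟩
  (eTerm m 0 N - eTerm (suc m) 0 N) + ∑[ i < N ] (eTerm m (suc i) N - eTerm (suc m) (suc i) N)
    ≡⟨ cong₂ _+_ (eTerm-difference-zero m N) (∑-cong N (λ i _ → eTerm-difference-suc m i N)) ⟩
  0ℤ + ∑[ i < N ] (q^ suc (suc m) · eTerm (suc (suc m)) i) N
    ≡⟨ ℤ.+-identityˡ _ ⟩
  ∑[ i < N ] (q^ suc (suc m) · eTerm (suc (suc m)) i) N
    ≡⟨ shift-∑ₛ (eTerm (suc (suc m))) (eTerm-summable (suc (suc m))) (suc (suc m)) N (ℕ.m<m+n N (s≤s z≤n)) ⟩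
  (q^ suc (suc m) · E (suc (suc m))) N ∎)
  where
  open ≡-Reasoning
  move : ∀ {x y z} → x - y ≡ z → x ≡ y + z
  move {x} {y} refl = shuffle x y
    where
    shuffle : ∀ x y → x ≡ y + (x - y)
    shuffle = ℤ-Solver.solve-∀

E-initial : ∀ m {N} → N ≤ m → E m N ≡ qPoch∞ 1 N
E-initial m {N} N≤m =
  trans (∑-head N (λ j → eTerm m j N))
    (trans (cong₂ _+_ (cong (λ e → (q^ e · qPoch∞ 1) N) (ℕ.*-zeroʳ (suc m)))
                      (∑-zero N (λ i → shift-below _ _
                        (ℕ.≤-trans (s≤s (ℕ.≤-trans N≤m (ℕ.m≤m+n m _))) (ℕ.≤-reflexive (sym (arith i m)))))))
      (ℤ.+-identityʳ _))
  where
  arith : ∀ i m → suc i ℕ.* suc i ℕ.+ suc m ℕ.* suc i ≡ suc (m ℕ.+ (i ℕ.* i ℕ.+ 3 ℕ.* i ℕ.+ m ℕ.* i ℕ.+ 1))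
  arith = ℕ-Solver.solve-∀

A-initial : ∀ m {N} → N ≤ m → A m N ≡ qPoch∞ 1 N
A-initial m {N} N≤m =
  trans (∑-head N (λ n → aTerm m n N))
    (trans (cong₂ _+_ aTerm-zero
      (∑-zero N (λ i → signed-shift-below (-1^ suc i) _ _
        (ℕ.≤-trans (s≤s (ℕ.≤-trans N≤m (ℕ.m≤m+n m _))) (ℕ.≤-reflexive (sym (arith (α i) i m)))))))
    (ℤ.+-identityʳ _))
  where
  arith : ∀ a i m → a ℕ.+ (5 ℕ.* i ℕ.+ 4) ℕ.+ 2 ℕ.* m ℕ.* suc i ≡ suc (m ℕ.+ (a ℕ.+ 5 ℕ.* i ℕ.+ 3 ℕ.+ 2 ℕ.* m ℕ.* i ℕ.+ m))
  arith = ℕ-Solver.solve-∀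
  aTerm-zero : aTerm m 0 N ≡ qPoch∞ 1 N
  aTerm-zero = begin
    1ℤ * (q^ (2 ℕ.* m ℕ.* 0) · [1-q^ k ]· qPoch 1 m) N
      ≡⟨ ℤ.*-identityˡ _ ⟩
    (q^ (2 ℕ.* m ℕ.* 0) · [1-q^ k ]· qPoch 1 m) N
      ≡⟨ cong (λ e → (q^ e · [1-q^ k ]· qPoch 1 m) N) (ℕ.*-zeroʳ (2 ℕ.* m)) ⟩
    qPoch 1 m N - (q^ k · qPoch 1 m) N
      ≡⟨ cong (λ t → qPoch 1 m N - t) (shift-below k (qPoch 1 m) (ℕ.≤-trans (s≤s N≤m) (ℕ.≤-reflexive (sym (k≡ m))))) ⟩
    qPoch 1 m N - 0ℤ
      ≡⟨ ℤ.+-identityʳ _ ⟩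
    qPoch 1 m N
      ≡⟨ qPoch≡qPoch∞ 1 m (s≤s N≤m) ⟩
    qPoch∞ 1 N ∎
    where
    open ≡-Reasoning
    k = m ℕ.+ 1 ℕ.+ 0
    k≡ : ∀ m → m ℕ.+ 1 ℕ.+ 0 ≡ suc m
    k≡ = ℕ-Solver.solve-∀

E≗A : ∀ m → E m ≗ A m
E≗A = recurrence-unique E-recurrence A-recurrence (λ m N≤m → trans (E-initial m N≤m) (sym (A-initial m N≤m)))

γ : ℕ → ℕ
γ k = α k ℕ.+ suc (2 ℕ.* k)

seriesExponent : ℤ → ℕ
seriesExponent (+ i) = α i
seriesExponent -[1+ k ] = γ k

monomial : ℕ → Series
monomial e = q^ e · 1ₛ

monomial-self : ∀ e → monomial e e ≡ 1ℤ
monomial-self e = trans (shift-above e 1ₛ ℕ.≤-refl) (cong 1ₛ (ℕ.n∸n≡0 e))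

monomial-other : ∀ e {n} → n ≢ e → monomial e n ≡ 0ℤ
monomial-other e {n} n≢e with e ℕ.≤? n
... | no e≰n = shift-below e 1ₛ (ℕ.≰⇒> e≰n)
... | yes e≤n with n ∸ e in n∸e≡
...   | zero = ⊥-elim (n≢e (ℕ.≤-antisym (ℕ.m∸n≡0⇒m≤n n∸e≡) e≤n))
...   | suc _ = trans (shift-above e 1ₛ e≤n) (cong 1ₛ n∸e≡)

aTerm-zero : ∀ n N → aTerm 0 n N ≡ -1^ n * (monomial (α n) N - monomial (γ n) N)
aTerm-zero n N = cong (-1^ n *_) (trans (cong (λ e → (q^ e · [1-q^ suc (2 ℕ.* n) ]· 1ₛ) N) (ℕ.+-identityʳ (α n)))
                                        (shift-[1-q^] (α n) (suc (2 ℕ.* n)) 1ₛ N))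

strictMono⇒injective : ∀ (f : ℕ → ℕ) → (∀ {i k} → i < k → f i < f k) → ∀ {i k} → f i ≡ f k → i ≡ k
strictMono⇒injective f f-mono {i} {k} fi≡fk with ℕ.<-cmp i k
... | tri< i<k _ _ = ⊥-elim (ℕ.<-irrefl fi≡fk (f-mono i<k))
... | tri≈ _ i≡k _ = i≡k
... | tri> _ _ k<i = ⊥-elim (ℕ.<-irrefl (sym fi≡fk) (f-mono k<i))

α<γ : ∀ i → α i < γ i
α<γ i = ℕ.m<m+n (α i) (s≤s z≤n)

γ<α-suc : ∀ i → γ i < α (suc i)
γ<α-suc i = ℕ.+-monoʳ-< (α i) (ℕ.≤-trans (ℕ.m≤m+n (suc (suc (2 ℕ.* i))) (3 ℕ.* i ℕ.+ 2)) (ℕ.≤-reflexive (arith i)))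
  where
  arith : ∀ i → suc (suc (2 ℕ.* i)) ℕ.+ (3 ℕ.* i ℕ.+ 2) ≡ 5 ℕ.* i ℕ.+ 4
  arith = ℕ-Solver.solve-∀

α-mono-≤ : ∀ {i k} → i ≤ k → α i ≤ α k
α-mono-≤ {zero} _ = z≤n
α-mono-≤ {suc i} {suc k} (s≤s i≤k) = ℕ.+-mono-≤ (α-mono-≤ i≤k) (ℕ.+-monoˡ-≤ 4 (ℕ.*-monoʳ-≤ 5 i≤k))

α-mono-< : ∀ {i k} → i < k → α i < α k
α-mono-< {i} {suc k} (s≤s i≤k) = ℕ.≤-<-trans (α-mono-≤ i≤k) (ℕ.<-trans (α<γ k) (γ<α-suc k))

γ-mono-< : ∀ {i k} → i < k → γ i < γ k
γ-mono-< {i} {k} i<k = ℕ.<-trans (ℕ.<-≤-trans (γ<α-suc i) (α-mono-≤ i<k)) (α<γ k)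

α≢γ : ∀ i k → α i ≢ γ k
α≢γ i k αi≡γk with i ℕ.≤? k
... | yes i≤k = ℕ.<-irrefl αi≡γk (ℕ.≤-<-trans (α-mono-≤ i≤k) (α<γ k))
... | no i≰k = ℕ.<-irrefl (sym αi≡γk) (ℕ.<-≤-trans (γ<α-suc k) (α-mono-≤ (ℕ.≰⇒> i≰k)))

A₀-at-α : ∀ i → A 0 (α i) ≡ -1^ i
A₀-at-α i =
  trans (∑-single (suc (α i)) (λ n → aTerm 0 n (α i)) (s≤s (n≤α i)) others)
    (trans (aTerm-zero i (α i))
      (trans (cong₂ (λ x y → -1^ i * (x - y)) (monomial-self (α i)) (monomial-other (γ i) (α≢γ i i)))
        (ℤ.*-identityʳ (-1^ i))))
  where
  others : ∀ n → n ≢ i → aTerm 0 n (α i) ≡ 0ℤ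
  others n n≢i = trans (aTerm-zero n (α i))
    (trans (cong₂ (λ x y → -1^ n * (x - y))
             (monomial-other (α n) (n≢i ∘ sym ∘ strictMono⇒injective α α-mono-<))
             (monomial-other (γ n) (α≢γ i n)))
      (ℤ.*-zeroʳ (-1^ n)))

A₀-at-γ : ∀ k → A 0 (γ k) ≡ - 1ℤ * -1^ k
A₀-at-γ k =
  trans (∑-single (suc (γ k)) (λ n → aTerm 0 n (γ k)) (s≤s (ℕ.≤-trans (n≤α k) (ℕ.<⇒≤ (α<γ k)))) others)
    (trans (aTerm-zero k (γ k))
      (trans (cong₂ (λ x y → -1^ k * (x - y)) (monomial-other (α k) (α≢γ k k ∘ sym)) (monomial-self (γ k)))
        (ℤ.*-comm (-1^ k) (- 1ℤ))))
  where
  others : ∀ n → n ≢ k → aTerm 0 n (γ k) ≡ 0ℤ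
  others n n≢k = trans (aTerm-zero n (γ k))
    (trans (cong₂ (λ x y → -1^ n * (x - y))
             (monomial-other (α n) (α≢γ n k ∘ sym))
             (monomial-other (γ n) (n≢k ∘ sym ∘ strictMono⇒injective γ γ-mono-<)))
      (ℤ.*-zeroʳ (-1^ n)))

A₀-at-seriesExponent : ∀ j → A 0 (seriesExponent j) ≡ negOnePow j
A₀-at-seriesExponent (+ i) = A₀-at-α i
A₀-at-seriesExponent -[1+ k ] = A₀-at-γ k

A₀-elsewhere : ∀ N → (∀ j → N ≢ seriesExponent j) → A 0 N ≡ 0ℤ
A₀-elsewhere N N≢exponent = ∑-zero (suc N) (λ n → trans (aTerm-zero n N)
  (trans (cong₂ (λ x y → -1^ n * (x - y))
           (monomial-other (α n) (N≢exponent (+ n)))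
           (monomial-other (γ n) (N≢exponent -[1+ n ])))
    (ℤ.*-zeroʳ (-1^ n))))

2α≡ : ∀ i → 2 ℕ.* α i ≡ 5 ℕ.* i ℕ.* i ℕ.+ 3 ℕ.* i
2α≡ zero = refl
2α≡ (suc i) = trans (distrib (α i) i) (trans (cong (ℕ._+ (10 ℕ.* i ℕ.+ 8)) (2α≡ i)) (complete i))
  where
  distrib : ∀ a i → 2 ℕ.* (a ℕ.+ (5 ℕ.* i ℕ.+ 4)) ≡ 2 ℕ.* a ℕ.+ (10 ℕ.* i ℕ.+ 8)
  distrib = ℕ-Solver.solve-∀
  complete : ∀ i → 5 ℕ.* i ℕ.* i ℕ.+ 3 ℕ.* i ℕ.+ (10 ℕ.* i ℕ.+ 8) ≡ 5 ℕ.* suc i ℕ.* suc i ℕ.+ 3 ℕ.* suc i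
  complete = ℕ-Solver.solve-∀

2γ≡ : ∀ k → 2 ℕ.* γ k ≡ 5 ℕ.* k ℕ.* k ℕ.+ 7 ℕ.* k ℕ.+ 2
2γ≡ k = trans (distrib (α k) k) (trans (cong (ℕ._+ (4 ℕ.* k ℕ.+ 2)) (2α≡ k)) (complete k))
  where
  distrib : ∀ a k → 2 ℕ.* (a ℕ.+ suc (2 ℕ.* k)) ≡ 2 ℕ.* a ℕ.+ (4 ℕ.* k ℕ.+ 2)
  distrib = ℕ-Solver.solve-∀
  complete : ∀ k → 5 ℕ.* k ℕ.* k ℕ.+ 3 ℕ.* k ℕ.+ (4 ℕ.* k ℕ.+ 2) ≡ 5 ℕ.* k ℕ.* k ℕ.+ 7 ℕ.* k ℕ.+ 2
  complete = ℕ-Solver.solve-∀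

+-quadratic : ∀ a b c x → + (a ℕ.* x ℕ.* x ℕ.+ b ℕ.* x ℕ.+ c) ≡ + a * + x * + x + + b * + x + + c
+-quadratic a b c x =
  trans (ℤ.pos-+ (a ℕ.* x ℕ.* x ℕ.+ b ℕ.* x) c)
    (cong (_+ + c) (trans (ℤ.pos-+ (a ℕ.* x ℕ.* x) (b ℕ.* x))
      (cong₂ _+_ (trans (ℤ.pos-* (a ℕ.* x) x) (cong (_* + x) (ℤ.pos-* a x))) (ℤ.pos-* b x))))

2*seriesExponent : ∀ j → + 2 * + seriesExponent j ≡ + 5 * j * j + + 3 * j
2*seriesExponent (+ i) = begin
  + 2 * + α i                          ≡⟨ ℤ.pos-* 2 (α i) ⟨
  + (2 ℕ.* α i)                        ≡⟨ cong +_ (trans (2α≡ i) (sym (ℕ.+-identityʳ _))) ⟩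
  + (5 ℕ.* i ℕ.* i ℕ.+ 3 ℕ.* i ℕ.+ 0)   ≡⟨ +-quadratic 5 3 0 i ⟩
  + 5 * + i * + i + + 3 * + i + + 0     ≡⟨ ℤ.+-identityʳ _ ⟩
  + 5 * + i * + i + + 3 * + i           ∎
  where open ≡-Reasoning
2*seriesExponent -[1+ k ] = begin
  + 2 * + γ k                                             ≡⟨ ℤ.pos-* 2 (γ k) ⟨
  + (2 ℕ.* γ k)                                           ≡⟨ cong +_ (2γ≡ k) ⟩
  + (5 ℕ.* k ℕ.* k ℕ.+ 7 ℕ.* k ℕ.+ 2)                      ≡⟨ +-quadratic 5 7 2 k ⟩
  + 5 * + k * + k + + 7 * + k + + 2                       ≡⟨ negate (+ k) ⟩
  + 5 * - (+ k + 1ℤ) * - (+ k + 1ℤ) + + 3 * - (+ k + 1ℤ)  ≡⟨ cong (λ t → + 5 * - t * - t + + 3 * - t) (ℤ.+-comm (+ k) 1ℤ) ⟩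
  + 5 * -[1+ k ] * -[1+ k ] + + 3 * -[1+ k ]              ∎
  where
  open ≡-Reasoning
  negate : ∀ x → + 5 * x * x + + 7 * x + + 2 ≡ + 5 * - (x + 1ℤ) * - (x + 1ℤ) + + 3 * - (x + 1ℤ)
  negate = ℤ-Solver.solve-∀

A₀-closed-form : ∀ N →
  (∀ j → + 2 * + N ≡ + 5 * j * j + + 3 * j → A 0 N ≡ negOnePow j)
  × ((∀ j → + 2 * + N ≢ + 5 * j * j + + 3 * j) → A 0 N ≡ + 0)
A₀-closed-form N = at-exponent , elsewhere
  where
  at-exponent : ∀ j → + 2 * + N ≡ + 5 * j * j + + 3 * j → A 0 N ≡ negOnePow j
  at-exponent j 2N≡ with ℤ.+-injective (ℤ.*-cancelˡ-≡ (+ 2) (+ N) (+ seriesExponent j) (trans 2N≡ (sym (2*seriesExponent j))))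
  ... | refl = A₀-at-seriesExponent j
  elsewhere : (∀ j → + 2 * + N ≢ + 5 * j * j + + 3 * j) → A 0 N ≡ + 0
  elsewhere 2N≢ = A₀-elsewhere N (λ j N≡ → 2N≢ j (trans (cong (λ t → + 2 * + t) N≡) (2*seriesExponent j)))

mult-here : ∀ x l → mult x (x ∷ l) ≡ suc (mult x l)
mult-here x l = cong length (List.filter-accept (_≟ x) refl)

mult-there : ∀ x {y} l → y ≢ x → mult x (y ∷ l) ≡ mult x l
mult-there x l y≢x = cong length (List.filter-reject (_≟ x) y≢x)

mult-++ : ∀ x a b → mult x (a ++ b) ≡ mult x a ℕ.+ mult x b
mult-++ x a b = trans (cong length (List.filter-++ (_≟ x) a b)) (List.length-++ (filter (_≟ x) a))

mult-absent : ∀ x {l} → All (_≢ x) l → mult x l ≡ 0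
mult-absent x all≢ = cong length (List.filter-none (_≟ x) all≢)

mult≡0⇒absent : ∀ x l → mult x l ≡ 0 → All (_≢ x) l
mult≡0⇒absent x [] _ = []
mult≡0⇒absent x (y ∷ l) mult≡0 with y ≟ x
... | yes refl = ⊥-elim (ℕ.0≢1+n (trans (sym mult≡0) (mult-here x l)))
... | no y≢x = y≢x ∷ mult≡0⇒absent x l (trans (sym (mult-there x l y≢x)) mult≡0)

mult-≤-∷ : ∀ x y l → mult x l ≤ mult x (y ∷ l)
mult-≤-∷ x y l with y ≟ x
... | yes refl = ℕ.≤-trans (ℕ.n≤1+n _) (ℕ.≤-reflexive (sym (mult-here x l)))
... | no y≢x = ℕ.≤-reflexive (sym (mult-there x l y≢x))

staircase : ℕ → List ℕ
staircase zero = []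
staircase (suc j) = suc j ∷ suc j ∷ staircase j

oblong : ℕ → ℕ
oblong j = j ℕ.* j ℕ.+ j

staircase-bounds : ∀ j → All (λ y → 1 ≤ y × y ≤ j) (staircase j)
staircase-bounds zero = []
staircase-bounds (suc j) = (s≤s z≤n , ℕ.≤-refl) ∷ (s≤s z≤n , ℕ.≤-refl) ∷ All.map (Product.map₂ ℕ.m≤n⇒m≤1+n) (staircase-bounds j)

mult-staircase-above : ∀ j {x} → j < x → mult x (staircase j) ≡ 0
mult-staircase-above j j<x = mult-absent _ (All.map (λ (_ , y≤j) y≡x → ℕ.<-irrefl y≡x (ℕ.≤-<-trans y≤j j<x)) (staircase-bounds j))

mult-staircase-within : ∀ j {x} → 1 ≤ x → x ≤ j → mult x (staircase j) ≡ 2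
mult-staircase-within zero 1≤x x≤0 with () ← ℕ.≤-trans 1≤x x≤0
mult-staircase-within (suc j) {x} 1≤x x≤j with x ≟ suc j
... | yes refl rewrite mult-here (suc j) (suc j ∷ staircase j) | mult-here (suc j) (staircase j)
                     | mult-staircase-above j (ℕ.n<1+n j) = refl
... | no x≢j rewrite mult-there x (suc j ∷ staircase j) (x≢j ∘ sym) | mult-there x (staircase j) (x≢j ∘ sym)
  = mult-staircase-within j 1≤x (ℕ.≤-pred (ℕ.≤∧≢⇒< x≤j x≢j))

sum-staircase : ∀ j → sum (staircase j) ≡ oblong j
sum-staircase zero = refl
sum-staircase (suc j) rewrite sum-staircase j = arith j
  where
  arith : ∀ j → suc j ℕ.+ (suc j ℕ.+ (j ℕ.* j ℕ.+ j)) ≡ suc j ℕ.* suc j ℕ.+ suc j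
  arith = ℕ-Solver.solve-∀

staircase-sorted : ∀ j → AllPairs _≥_ (staircase j)
staircase-sorted zero = []
staircase-sorted (suc j) = (ℕ.≤-refl ∷ below) ∷ below ∷ staircase-sorted j
  where
  below : All (_≤ suc j) (staircase j)
  below = All.map (ℕ.m≤n⇒m≤1+n ∘ proj₂) (staircase-bounds j)

Strict : ℕ → List ℕ → Set
Strict k μ = AllPairs _>_ μ × All (k ≤_) μ

mult-distinct-∈ : ∀ {μ x} → AllPairs _>_ μ → x ∈ μ → mult x μ ≡ 1
mult-distinct-∈ {x ∷ xs} (xs<x ∷ _) (here refl) =
  trans (mult-here x xs) (cong suc (mult-absent x (All.map (λ y<x y≡x → ℕ.<-irrefl y≡x y<x) xs<x)))
mult-distinct-∈ {y ∷ ys} (ys<y ∷ ys-distinct) (there x∈ys) =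
  trans (mult-there _ ys (λ y≡x → ℕ.<-irrefl (sym y≡x) (All.lookup ys<y x∈ys))) (mult-distinct-∈ ys-distinct x∈ys)

mult-distinct-≤1 : ∀ {μ} x → AllPairs _>_ μ → mult x μ ≤ 1
mult-distinct-≤1 x [] = z≤n
mult-distinct-≤1 {y ∷ ys} x (ys<y ∷ ys-distinct) with y ≟ x
... | yes refl = ℕ.≤-reflexive (trans (mult-here x ys) (cong suc (mult-absent x (All.map (λ z<x z≡x → ℕ.<-irrefl z≡x z<x) ys<y))))
... | no y≢x = ℕ.≤-trans (ℕ.≤-reflexive (mult-there x ys y≢x)) (mult-distinct-≤1 x ys-distinct)

-1^-mod-2 : ∀ n → -1^ (n % 2) ≡ -1^ n
-1^-mod-2 zero = refl
-1^-mod-2 (suc zero) = refl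
-1^-mod-2 (suc (suc n)) = begin
  -1^ (suc (suc n) % 2)       ≡⟨ cong -1^_ (trans (cong (_% 2) (ℕ.+-comm 2 n)) ([m+n]%n≡m%n n 2)) ⟩
  -1^ (n % 2)                 ≡⟨ -1^-mod-2 n ⟩
  -1^ n                       ≡⟨ square-neutral (-1^ n) ⟨
  - 1ℤ * (- 1ℤ * -1^ n)       ∎
  where
  open ≡-Reasoning
  square-neutral : ∀ x → - 1ℤ * (- 1ℤ * x) ≡ x
  square-neutral = ℤ-Solver.solve-∀

weight≡-1^numDistinctParts : ∀ p → weight p ≡ -1^ numDistinctParts p
weight≡-1^numDistinctParts p with numDistinctParts p % 2 in parity
... | zero = trans (cong -1^_ (sym parity)) (-1^-mod-2 (numDistinctParts p))
... | suc zero = trans (cong -1^_ (sym parity)) (-1^-mod-2 (numDistinctParts p))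
... | suc (suc _) with s≤s () ← ℕ.≤-trans (ℕ.≤-reflexive (sym parity)) (ℕ.≤-pred (m%n<n (numDistinctParts p) 2))

module _ {j μ} (μ-strict : Strict (suc j) μ) where

  private
    μ-above-j : All (j <_) μ
    μ-above-j = proj₂ μ-strict

    mult-μ-within : ∀ {x} → x ≤ j → mult x μ ≡ 0
    mult-μ-within x≤j = mult-absent _ (All.map (λ j<y y≡x → ℕ.<-irrefl (sym y≡x) (ℕ.≤-<-trans x≤j j<y)) μ-above-j)

  mult-++staircase-∈ : ∀ {x} → x ∈ μ → mult x (μ ++ staircase j) ≡ 1
  mult-++staircase-∈ x∈μ = trans (mult-++ _ μ (staircase j))
    (trans (cong₂ ℕ._+_ (mult-distinct-∈ (proj₁ μ-strict) x∈μ) (mult-staircase-above j (All.lookup μ-above-j x∈μ))) refl)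

  mult-++staircase-above : ∀ {x} → j < x → mult x (μ ++ staircase j) ≤ 1
  mult-++staircase-above {x} j<x = ℕ.≤-trans
    (ℕ.≤-reflexive (trans (mult-++ x μ (staircase j)) (trans (cong (mult x μ ℕ.+_) (mult-staircase-above j j<x)) (ℕ.+-identityʳ _))))
    (mult-distinct-≤1 x (proj₁ μ-strict))

  mult-++staircase-within : ∀ {x} → 1 ≤ x → x ≤ j → mult x (μ ++ staircase j) ≡ 2
  mult-++staircase-within {x} 1≤x x≤j =
    trans (mult-++ x μ (staircase j)) (cong₂ ℕ._+_ (mult-μ-within x≤j) (mult-staircase-within j 1≤x x≤j))

  numDistinctParts-++staircase : numDistinctParts (μ ++ staircase j) ≡ length μ
  numDistinctParts-++staircase = begin
    length (filter once (μ ++ staircase j))                         ≡⟨ cong length (List.filter-++ once μ (staircase j)) ⟩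
    length (filter once μ ++ filter once (staircase j))             ≡⟨ List.length-++ (filter once μ) ⟩
    length (filter once μ) ℕ.+ length (filter once (staircase j))   ≡⟨ cong₂ ℕ._+_ (cong length (List.filter-all once all-once))
                                                                                   (cong length (List.filter-none once none-once)) ⟩
    length μ ℕ.+ 0                                                  ≡⟨ ℕ.+-identityʳ _ ⟩
    length μ                                                        ∎
    where
    open ≡-Reasoning
    once = λ x → mult x (μ ++ staircase j) ≟ 1
    all-once : All (λ x → mult x (μ ++ staircase j) ≡ 1) μ
    all-once = All.tabulate mult-++staircase-∈
    none-once : All (λ x → mult x (μ ++ staircase j) ≢ 1) (staircase j)
    none-once = All.map (λ (1≤x , x≤j) mult≡1 → 2≢1 (trans (sym (mult-++staircase-within 1≤x x≤j)) mult≡1)) (staircase-bounds j)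
      where
      2≢1 : 2 ≢ 1
      2≢1 ()

  weight-++staircase : weight (μ ++ staircase j) ≡ -1^ length μ
  weight-++staircase = trans (weight≡-1^numDistinctParts (μ ++ staircase j)) (cong -1^_ numDistinctParts-++staircase)

module _ {j μ} (μ-strict : Strict (suc j) μ) where

  ++staircase-sorted : AllPairs _≥_ (μ ++ staircase j)
  ++staircase-sorted = AllPairs.++⁺ (AllPairs.map ℕ.<⇒≤ (proj₁ μ-strict)) (staircase-sorted j)
    (All.map (λ j<x → All.map (λ (_ , y≤j) → ℕ.≤-trans y≤j (ℕ.<⇒≤ j<x)) (staircase-bounds j)) (proj₂ μ-strict))

  ++staircase-isPartition : ∀ {n} → sum μ ℕ.+ oblong j ≡ n → IsPartitionOf n (μ ++ staircase j)
  ++staircase-isPartition {n} sum≡n =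
    AllPairs⇒Linked ++staircase-sorted ,
    All.++⁺ (All.map (ℕ.≤-trans (s≤s z≤n)) (proj₂ μ-strict)) (All.map proj₁ (staircase-bounds j)) ,
    trans (sum-++ μ (staircase j)) (trans (cong (sum μ ℕ.+_) (sum-staircase j)) sum≡n)

++staircase-C4 : ∀ j {μ} → Strict (suc j) μ → C4 (μ ++ staircase j)
++staircase-C4 zero {μ} μ-strict = caseA distinct
  where
  distinct : AllDistinct (μ ++ [])
  distinct zero = ℕ.≤-trans (ℕ.≤-reflexive (mult-absent 0 (All.++⁺ (All.map (λ 0<x x≡0 → ℕ.<-irrefl (sym x≡0) 0<x) (proj₂ μ-strict)) []))) z≤n
  distinct (suc x) = mult-++staircase-above μ-strict (s≤s z≤n)
++staircase-C4 (suc i) μ-strict =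
  caseB (suc i , s≤s z≤n , mult-++staircase-within μ-strict (s≤s z≤n) ℕ.≤-refl ,
         (λ x 1≤x x<j → mult-++staircase-within μ-strict 1≤x (ℕ.<⇒≤ x<j)) ,
         (λ x j<x → mult-++staircase-above μ-strict j<x))

mult-pos⇒∈ : ∀ x l → 0 < mult x l → x ∈ l
mult-pos⇒∈ x (y ∷ l) pos with y ≟ x
... | yes refl = here refl
... | no y≢x = there (mult-pos⇒∈ x l (ℕ.<-≤-trans pos (ℕ.≤-reflexive (mult-there x l y≢x))))

mult-∷-cancel : ∀ z x {xs ys} → mult z (x ∷ xs) ≡ mult z (x ∷ ys) → mult z xs ≡ mult z ys
mult-∷-cancel z x {xs} {ys} eq with x ≟ z
... | yes refl = ℕ.suc-injective (trans (sym (mult-here z xs)) (trans eq (mult-here z ys)))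
... | no x≢z = trans (sym (mult-there z xs x≢z)) (trans eq (mult-there z ys x≢z))

sorted-head-max : ∀ {x xs z} → All (_≤ x) xs → z ∈ x ∷ xs → z ≤ x
sorted-head-max _ (here refl) = ℕ.≤-refl
sorted-head-max xs≤x (there z∈xs) = All.lookup xs≤x z∈xs

sorted-≡-by-mult : ∀ {xs ys} → AllPairs _≥_ xs → AllPairs _≥_ ys → (∀ z → mult z xs ≡ mult z ys) → xs ≡ ys
sorted-≡-by-mult [] [] same = refl
sorted-≡-by-mult {[]} {y ∷ ys} [] _ same = ⊥-elim (ℕ.0≢1+n (trans (same y) (mult-here y ys)))
sorted-≡-by-mult {x ∷ xs} {[]} _ [] same = ⊥-elim (ℕ.0≢1+n (trans (sym (same x)) (mult-here x xs)))
sorted-≡-by-mult {x ∷ xs} {y ∷ ys} (xs≤x ∷ xs-sorted) (ys≤y ∷ ys-sorted) same =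
  cong₂ _∷_ x≡y (sorted-≡-by-mult xs-sorted ys-sorted tails)
  where
  x≤y : x ≤ y
  x≤y = sorted-head-max ys≤y (mult-pos⇒∈ x (y ∷ ys) (ℕ.<-≤-trans (s≤s z≤n) (ℕ.≤-reflexive (trans (sym (mult-here x xs)) (same x)))))
  y≤x : y ≤ x
  y≤x = sorted-head-max xs≤x (mult-pos⇒∈ y (x ∷ xs) (ℕ.<-≤-trans (s≤s z≤n) (ℕ.≤-reflexive (trans (sym (mult-here y ys)) (sym (same y))))))
  x≡y : x ≡ y
  x≡y = ℕ.≤-antisym x≤y y≤x
  tails : ∀ z → mult z xs ≡ mult z ys
  tails z = mult-∷-cancel z x (trans (same z) (cong (λ w → mult z (w ∷ ys)) (sym x≡y)))

≡staircase : ∀ j {p} → AllPairs _≥_ p → All (λ y → 1 ≤ y × y ≤ j) p →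
  (∀ i → 1 ≤ i → i ≤ j → mult i p ≡ 2) → p ≡ staircase j
≡staircase j {p} p-sorted p-bounds twice = sorted-≡-by-mult p-sorted (staircase-sorted j) same
  where
  same : ∀ z → mult z p ≡ mult z (staircase j)
  same zero = trans (mult-absent 0 (All.map (λ (1≤y , _) y≡0 → ℕ.<-irrefl (sym y≡0) 1≤y) p-bounds))
                    (sym (mult-absent 0 (All.map (λ (1≤y , _) y≡0 → ℕ.<-irrefl (sym y≡0) 1≤y) (staircase-bounds j))))
  same (suc z) with suc z ℕ.≤? j
  ... | yes z<j = trans (twice (suc z) (s≤s z≤n) z<j) (sym (mult-staircase-within j (s≤s z≤n) z<j))
  ... | no z≮j = trans (mult-absent (suc z) (All.map (λ (_ , y≤j) y≡z → z≮j (subst (_≤ j) y≡z y≤j)) p-bounds))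
                       (sym (mult-staircase-above j (ℕ.≰⇒> z≮j)))

StaircaseMultiplicities : ℕ → List ℕ → Set
StaircaseMultiplicities j p = (∀ i → 1 ≤ i → i ≤ j → mult i p ≡ 2) × (∀ i → j < i → mult i p ≤ 1)

C4⇒StaircaseMultiplicities : ∀ {p} → C4 p → Σ ℕ λ j → StaircaseMultiplicities j p
C4⇒StaircaseMultiplicities (caseA distinct) = 0 , (λ i 1≤i i≤0 → ⊥-elim (ℕ.<-irrefl refl (ℕ.<-≤-trans 1≤i i≤0))) , (λ i _ → distinct i)
C4⇒StaircaseMultiplicities (caseB (j , _ , mult-j , mult-below , mult-above)) = j , twice , mult-above
  where
  twice : ∀ i → 1 ≤ i → i ≤ j → _
  twice i 1≤i i≤j with i ≟ j
  ... | yes refl = mult-j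
  ... | no i≢j = mult-below i 1≤i (ℕ.≤∧≢⇒< i≤j i≢j)

decompose : ∀ j {p} → AllPairs _≥_ p → All (1 ≤_) p → StaircaseMultiplicities j p →
  Σ (List ℕ) λ μ → Strict (suc j) μ × p ≡ μ ++ staircase j
decompose j {[]} [] [] (twice , _) = [] , ([] , []) , ≡staircase j [] [] twice
decompose j {x ∷ p} (p≤x ∷ p-sorted) (1≤x ∷ p-positive) (twice , once) with j ℕ.<? x
... | no x≤j = [] , ([] , []) , ≡staircase j (p≤x ∷ p-sorted) bounds twice
  where
  bounds : All (λ y → 1 ≤ y × y ≤ j) (x ∷ p)
  bounds = (1≤x , ℕ.≮⇒≥ x≤j) ∷ All.zipWith (λ (1≤y , y≤x) → 1≤y , ℕ.≤-trans y≤x (ℕ.≮⇒≥ x≤j)) (p-positive , p≤x)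
... | yes j<x with decompose j p-sorted p-positive (twice′ , once′)
  where
  twice′ : ∀ i → 1 ≤ i → i ≤ j → mult i p ≡ 2
  twice′ i 1≤i i≤j = trans (sym (mult-there i p (λ x≡i → ℕ.<-irrefl (sym x≡i) (ℕ.≤-<-trans i≤j j<x)))) (twice i 1≤i i≤j)
  once′ : ∀ i → j < i → mult i p ≤ 1
  once′ i j<i = ℕ.≤-trans (mult-≤-∷ i x p) (once i j<i)
... | μ , (μ-distinct , μ-above) , refl = x ∷ μ , (μ<x ∷ μ-distinct , j<x ∷ μ-above) , refl
  where
  x∉p : All (_≢ x) (μ ++ staircase j)
  x∉p = mult≡0⇒absent x _ (ℕ.n≤0⇒n≡0 (ℕ.≤-pred (ℕ.≤-trans (ℕ.≤-reflexive (sym (mult-here x _))) (once x j<x))))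
  μ<x : All (_< x) μ
  μ<x = All.++⁻ˡ μ (All.zipWith (λ (y≤x , y≢x) → ℕ.≤∧≢⇒< y≤x y≢x) (p≤x , x∉p))

-- strictPartitions k b n enumerates the partitions of n into distinct parts from [k, k + b).
strictPartitions : ℕ → ℕ → ℕ → List (List ℕ)
strictPartitions k zero zero = [] ∷ []
strictPartitions k zero (suc n) = []
strictPartitions k (suc b) n with k ℕ.+ b ℕ.≤? n
... | yes _ = strictPartitions k b n ++ map (k ℕ.+ b ∷_) (strictPartitions k b (n ∸ (k ℕ.+ b)))
... | no _ = strictPartitions k b n

private
  <-+-suc : ∀ {k b x} → x < k ℕ.+ b → x < k ℕ.+ suc b
  <-+-suc {k} {b} x<k+b = ℕ.<-≤-trans x<k+b (ℕ.≤-trans (ℕ.n≤1+n _) (ℕ.≤-reflexive (sym (ℕ.+-suc k b))))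

strictPartitions-sound : ∀ k b n {μ} → μ ∈ strictPartitions k b n → Strict k μ × All (_< k ℕ.+ b) μ × sum μ ≡ n
strictPartitions-sound k zero zero (here refl) = ([] , []) , [] , refl
strictPartitions-sound k (suc b) n μ∈ with k ℕ.+ b ℕ.≤? n
... | no _ = Product.map₂ (Product.map₁ (All.map <-+-suc)) (strictPartitions-sound k b n μ∈)
... | yes k+b≤n with ∈-++⁻ (strictPartitions k b n) μ∈
...   | inj₁ μ∈₁ = Product.map₂ (Product.map₁ (All.map <-+-suc)) (strictPartitions-sound k b n μ∈₁)
...   | inj₂ μ∈₂ with ∈-map⁻ (k ℕ.+ b ∷_) μ∈₂
...     | ν , ν∈ , refl with strictPartitions-sound k b (n ∸ (k ℕ.+ b)) ν∈
...       | (ν-distinct , ν≥k) , ν<k+b , sum-ν =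
  (ν<k+b ∷ ν-distinct , ℕ.m≤m+n k b ∷ ν≥k) , ℕ.≤-reflexive (sym (ℕ.+-suc k b)) ∷ All.map <-+-suc ν<k+b ,
  trans (cong (k ℕ.+ b ℕ.+_) sum-ν) (ℕ.m+[n∸m]≡n k+b≤n)

strictPartitions-⊆-suc : ∀ k b n {μ} → μ ∈ strictPartitions k b n → μ ∈ strictPartitions k (suc b) n
strictPartitions-⊆-suc k b n μ∈ with k ℕ.+ b ℕ.≤? n
... | yes _ = ∈-++⁺ˡ μ∈
... | no _ = μ∈

strictPartitions-complete : ∀ k b n {μ} → Strict k μ → All (_< k ℕ.+ b) μ → sum μ ≡ n → μ ∈ strictPartitions k b n
strictPartitions-complete k zero zero {[]} _ _ refl = here refl
strictPartitions-complete k zero n {x ∷ μ} (_ , k≤x ∷ _) (x<k+0 ∷ _) _ =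
  ⊥-elim (ℕ.<-irrefl refl (ℕ.<-≤-trans x<k+0 (ℕ.≤-trans (ℕ.≤-reflexive (ℕ.+-identityʳ k)) k≤x)))
strictPartitions-complete k (suc b) n {[]} μ-strict _ sum≡n =
  strictPartitions-⊆-suc k b n (strictPartitions-complete k b n μ-strict [] sum≡n)
strictPartitions-complete k (suc b) n {x ∷ μ} μ-strict@(μ<x ∷ μ-distinct , _ ∷ μ≥k) (x<k+b+1 ∷ _) sum≡n with x ≟ k ℕ.+ b
... | no x≢k+b = strictPartitions-⊆-suc k b n
  (strictPartitions-complete k b n μ-strict (x<k+b ∷ All.map (λ y<x → ℕ.<-trans y<x x<k+b) μ<x) sum≡n)
  where
  x<k+b : x < k ℕ.+ b
  x<k+b = ℕ.≤∧≢⇒< (ℕ.≤-pred (ℕ.≤-trans x<k+b+1 (ℕ.≤-reflexive (ℕ.+-suc k b)))) x≢k+b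
... | yes refl with k ℕ.+ b ℕ.≤? n
...   | yes _ = ∈-++⁺ʳ (strictPartitions k b n) (∈-map⁺ (k ℕ.+ b ∷_)
                  (strictPartitions-complete k b (n ∸ (k ℕ.+ b)) (μ-distinct , μ≥k) μ<x
                     (trans (sym (ℕ.m+n∸m≡n (k ℕ.+ b) (sum μ))) (cong (_∸ (k ℕ.+ b)) sum≡n))))
...   | no k+b≰n = ⊥-elim (k+b≰n (ℕ.≤-trans (ℕ.m≤m+n (k ℕ.+ b) (sum μ)) (ℕ.≤-reflexive sum≡n)))

strictPartitions-unique : ∀ k b n → Unique (strictPartitions k b n)
strictPartitions-unique k zero zero = [] ∷ []
strictPartitions-unique k zero (suc n) = []
strictPartitions-unique k (suc b) n with k ℕ.+ b ℕ.≤? n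
... | yes _ = Unique.++⁺ (strictPartitions-unique k b n)
                (Unique.map⁺ List.∷-injectiveʳ (strictPartitions-unique k b (n ∸ (k ℕ.+ b)))) disjoint
  where
  disjoint : ∀ {μ} → ¬ (μ ∈ strictPartitions k b n × μ ∈ map (k ℕ.+ b ∷_) (strictPartitions k b (n ∸ (k ℕ.+ b))))
  disjoint (μ∈₁ , μ∈₂) with ∈-map⁻ (k ℕ.+ b ∷_) μ∈₂
  ... | _ , _ , refl with strictPartitions-sound k b n μ∈₁
  ...   | _ , (k+b<k+b ∷ _) , _ = ℕ.<-irrefl refl k+b<k+b
... | no _ = strictPartitions-unique k b n

∑ₗ : ∀ {A : Set} → (A → ℤ) → List A → ℤ
∑ₗ f [] = 0ℤ
∑ₗ f (x ∷ xs) = f x + ∑ₗ f xs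

∑ₗ-++ : ∀ {A : Set} (f : A → ℤ) xs {ys} → ∑ₗ f (xs ++ ys) ≡ ∑ₗ f xs + ∑ₗ f ys
∑ₗ-++ f [] = sym (ℤ.+-identityˡ _)
∑ₗ-++ f (x ∷ xs) {ys} rewrite ∑ₗ-++ f xs {ys} = sym (ℤ.+-assoc (f x) (∑ₗ f xs) (∑ₗ f ys))

∑ₗ-map : ∀ {A B : Set} (f : B → ℤ) (g : A → B) xs → ∑ₗ f (map g xs) ≡ ∑ₗ (f ∘ g) xs
∑ₗ-map f g [] = refl
∑ₗ-map f g (x ∷ xs) = cong (_+_ (f (g x))) (∑ₗ-map f g xs)

∑ₗ-*ˡ : ∀ {A : Set} c (f : A → ℤ) xs → ∑ₗ (λ x → c * f x) xs ≡ c * ∑ₗ f xs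
∑ₗ-*ˡ c f [] = sym (ℤ.*-zeroʳ c)
∑ₗ-*ˡ c f (x ∷ xs) rewrite ∑ₗ-*ˡ c f xs = sym (ℤ.*-distribˡ-+ c (f x) (∑ₗ f xs))

∑ₗ-cong : ∀ {A : Set} {f g : A → ℤ} xs → All (λ x → f x ≡ g x) xs → ∑ₗ f xs ≡ ∑ₗ g xs
∑ₗ-cong [] [] = refl
∑ₗ-cong (x ∷ xs) (fx≡gx ∷ rest) = cong₂ _+_ fx≡gx (∑ₗ-cong xs rest)

∑ₗ-↭ : ∀ {A : Set} (f : A → ℤ) {xs ys} → xs ↭ ys → ∑ₗ f xs ≡ ∑ₗ f ys
∑ₗ-↭ f ↭.refl = refl
∑ₗ-↭ f (↭.prep x xs↭ys) = cong (_+_ (f x)) (∑ₗ-↭ f xs↭ys)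
∑ₗ-↭ f (↭.swap x y xs↭ys) = trans (swap-heads (f x) (f y) _) (cong (λ s → f y + (f x + s)) (∑ₗ-↭ f xs↭ys))
  where
  swap-heads : ∀ a b s → a + (b + s) ≡ b + (a + s)
  swap-heads = ℤ-Solver.solve-∀
∑ₗ-↭ f (↭.trans xs↭ys ys↭zs) = trans (∑ₗ-↭ f xs↭ys) (∑ₗ-↭ f ys↭zs)

∑ₗ-strictPartitions : ∀ k b n → ∑ₗ (-1^_ ∘ length) (strictPartitions k b n) ≡ qPoch k b n
∑ₗ-strictPartitions k zero zero = refl
∑ₗ-strictPartitions k zero (suc n) = refl
∑ₗ-strictPartitions k (suc b) n with k ℕ.+ b ℕ.≤? n
... | yes k+b≤n = begin
  ∑ₗ sign (strictPartitions k b n ++ map (k ℕ.+ b ∷_) (strictPartitions k b n′))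
    ≡⟨ ∑ₗ-++ sign (strictPartitions k b n) ⟩
  ∑ₗ sign (strictPartitions k b n) + ∑ₗ sign (map (k ℕ.+ b ∷_) (strictPartitions k b n′))
    ≡⟨ cong (_+_ (∑ₗ sign (strictPartitions k b n)))
            (trans (∑ₗ-map sign (k ℕ.+ b ∷_) (strictPartitions k b n′)) (∑ₗ-*ˡ (- 1ℤ) sign (strictPartitions k b n′))) ⟩
  ∑ₗ sign (strictPartitions k b n) + - 1ℤ * ∑ₗ sign (strictPartitions k b n′)
    ≡⟨ cong₂ (λ x y → x + - 1ℤ * y) (∑ₗ-strictPartitions k b n) (∑ₗ-strictPartitions k b n′) ⟩
  qPoch k b n + - 1ℤ * qPoch k b n′
    ≡⟨ cong (_+_ (qPoch k b n)) (ℤ.-1*i≡-i (qPoch k b n′)) ⟩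
  qPoch k b n - qPoch k b n′
    ≡⟨ cong (λ t → qPoch k b n - t) (shift-above (k ℕ.+ b) (qPoch k b) k+b≤n) ⟨
  qPoch k (suc b) n ∎
  where
  open ≡-Reasoning
  sign = -1^_ ∘ length
  n′ = n ∸ (k ℕ.+ b)
... | no k+b≰n = trans (∑ₗ-strictPartitions k b n)
  (trans (sym (ℤ.+-identityʳ _)) (cong (λ t → qPoch k b n - t) (sym (shift-below (k ℕ.+ b) (qPoch k b) (ℕ.≰⇒> k+b≰n)))))

-- The c₄-partitions of n with staircase j, listed by their distinct parts μ > j.
block : ℕ → ℕ → List (List ℕ)
block n j with oblong j ℕ.≤? n
... | yes _ = map (_++ staircase j) (strictPartitions (suc j) (suc (n ∸ oblong j)) (n ∸ oblong j))
... | no _ = []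

blocksBelow : ℕ → ℕ → List (List ℕ)
blocksBelow n zero = []
blocksBelow n (suc J) = blocksBelow n J ++ block n J

c4Partitions : ℕ → List (List ℕ)
c4Partitions n = blocksBelow n (suc n)

StaircaseDecomposition : ℕ → ℕ → List ℕ → Set
StaircaseDecomposition n j p = Σ (List ℕ) λ μ → Strict (suc j) μ × sum μ ℕ.+ oblong j ≡ n × p ≡ μ ++ staircase j

block⁻ : ∀ n j {p} → p ∈ block n j → StaircaseDecomposition n j p
block⁻ n j p∈ with oblong j ℕ.≤? n
... | yes oblong≤n with ∈-map⁻ (_++ staircase j) p∈
...   | μ , μ∈ , refl with strictPartitions-sound (suc j) (suc (n ∸ oblong j)) (n ∸ oblong j) μ∈
...     | μ-strict , _ , sum≡ = μ , μ-strict , trans (cong (ℕ._+ oblong j) sum≡) (ℕ.m∸n+n≡m oblong≤n) , refl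

block⁺ : ∀ n j {μ} → Strict (suc j) μ → sum μ ℕ.+ oblong j ≡ n → μ ++ staircase j ∈ block n j
block⁺ n j {μ} μ-strict total with oblong j ℕ.≤? n
... | no oblong≰n = ⊥-elim (oblong≰n (ℕ.≤-trans (ℕ.m≤n+m (oblong j) (sum μ)) (ℕ.≤-reflexive total)))
... | yes _ = ∈-map⁺ (_++ staircase j) (strictPartitions-complete (suc j) (suc (n ∸ oblong j)) (n ∸ oblong j) μ-strict bounded sum≡)
  where
  sum≡ : sum μ ≡ n ∸ oblong j
  sum≡ = trans (sym (ℕ.m+n∸n≡m (sum μ) (oblong j))) (cong (_∸ oblong j) total)
  parts≤sum : ∀ l → All (_≤ sum l) l
  parts≤sum [] = []
  parts≤sum (x ∷ l) = ℕ.m≤m+n x (sum l) ∷ All.map (λ y≤ → ℕ.≤-trans y≤ (ℕ.m≤n+m (sum l) x)) (parts≤sum l)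
  bounded : All (_< suc j ℕ.+ suc (n ∸ oblong j)) μ
  bounded = All.map (λ x≤sum → s≤s (ℕ.≤-trans x≤sum (ℕ.≤-trans (ℕ.≤-reflexive sum≡) (ℕ.≤-trans (ℕ.n≤1+n _) (ℕ.m≤n+m _ j)))))
                    (parts≤sum μ)

blocksBelow⁻ : ∀ n J {p} → p ∈ blocksBelow n J → Σ ℕ λ j → j < J × p ∈ block n j
blocksBelow⁻ n (suc J) p∈ with ∈-++⁻ (blocksBelow n J) p∈
... | inj₁ p∈below = Product.map₂ (Product.map₁ ℕ.m<n⇒m<1+n) (blocksBelow⁻ n J p∈below)
... | inj₂ p∈block = J , ℕ.≤-refl , p∈block

blocksBelow⁺ : ∀ n J {j p} → j < J → p ∈ block n j → p ∈ blocksBelow n J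
blocksBelow⁺ n (suc J) {j} j<J p∈ with j ≟ J
... | yes refl = ∈-++⁺ʳ (blocksBelow n J) p∈
... | no j≢J = ∈-++⁺ˡ (blocksBelow⁺ n J (ℕ.≤∧≢⇒< (ℕ.≤-pred j<J) j≢J) p∈)

c4Partitions-sound : ∀ n {p} → p ∈ c4Partitions n → IsPartitionOf n p × C4 p
c4Partitions-sound n p∈ with blocksBelow⁻ n (suc n) p∈
... | j , _ , p∈block with block⁻ n j p∈block
...   | μ , μ-strict , total , refl = ++staircase-isPartition μ-strict total , ++staircase-C4 j μ-strict

c4Partitions-complete : ∀ n {p} → IsPartitionOf n p × C4 p → p ∈ c4Partitions n
c4Partitions-complete n {p} ((p-linked , p-positive , sum-p) , p-c4) with C4⇒StaircaseMultiplicities p-c4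
... | j , multiplicities with decompose j (Linked⇒AllPairs (λ y≤x z≤y → ℕ.≤-trans z≤y y≤x) p-linked) p-positive multiplicities
...   | μ , μ-strict , refl = blocksBelow⁺ n (suc n) (s≤s j≤n) (block⁺ n j μ-strict total)
  where
  total : sum μ ℕ.+ oblong j ≡ n
  total = trans (cong (sum μ ℕ.+_) (sym (sum-staircase j))) (trans (sym (sum-++ μ (staircase j))) sum-p)
  j≤n : j ≤ n
  j≤n = ℕ.≤-trans (ℕ.m≤n+m j (j ℕ.* j)) (ℕ.≤-trans (ℕ.m≤n+m (oblong j) (sum μ)) (ℕ.≤-reflexive total))

block-unique : ∀ n j → Unique (block n j)
block-unique n j with oblong j ℕ.≤? n
... | yes _ = Unique.map⁺ (List.++-cancelʳ (staircase j) _ _) (strictPartitions-unique (suc j) (suc (n ∸ oblong j)) (n ∸ oblong j))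
... | no _ = []

-- Blocks are disjoint: J occurs twice in the parts of block J but at most once in those of a lower block.
blocksBelow-unique : ∀ n J → Unique (blocksBelow n J)
blocksBelow-unique n zero = []
blocksBelow-unique n (suc J) = Unique.++⁺ (blocksBelow-unique n J) (block-unique n J) disjoint
  where
  disjoint : ∀ {p} → ¬ (p ∈ blocksBelow n J × p ∈ block n J)
  disjoint (p∈below , p∈block) with blocksBelow⁻ n J p∈below | block⁻ n J p∈block
  ... | j , j<J , p∈lower | _ , J-strict , _ , p≡ with block⁻ n j p∈lower
  ...   | _ , j-strict , _ , refl = 2≰1 (ℕ.≤-trans (ℕ.≤-reflexive (sym twice)) (mult-++staircase-above j-strict j<J))
    where
    twice = trans (cong (mult J) p≡) (mult-++staircase-within J-strict (ℕ.≤-trans (s≤s z≤n) j<J) ℕ.≤-refl)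
    2≰1 : ¬ (2 ≤ 1)
    2≰1 (s≤s ())

oblong≡ : ∀ j → oblong j ≡ j ℕ.* j ℕ.+ 1 ℕ.* j
oblong≡ j = cong (j ℕ.* j ℕ.+_) (sym (ℕ.*-identityˡ j))

∑ₗ-weight-block : ∀ n j → ∑ₗ weight (block n j) ≡ eTerm 0 j n
∑ₗ-weight-block n j with oblong j ℕ.≤? n
... | yes oblong≤n = begin
  ∑ₗ weight (map (_++ staircase j) μs)           ≡⟨ ∑ₗ-map weight (_++ staircase j) μs ⟩
  ∑ₗ (weight ∘ (_++ staircase j)) μs              ≡⟨ ∑ₗ-cong μs (All.tabulate (weight-++staircase ∘ proj₁ ∘ μs-sound)) ⟩
  ∑ₗ (-1^_ ∘ length) μs                           ≡⟨ ∑ₗ-strictPartitions (suc j) (suc (n ∸ oblong j)) (n ∸ oblong j) ⟩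
  qPoch∞ (suc j) (n ∸ oblong j)                   ≡⟨ shift-above (oblong j) (qPoch∞ (suc j)) oblong≤n ⟨
  (q^ oblong j · qPoch∞ (suc j)) n                ≡⟨ cong (λ e → (q^ e · qPoch∞ (suc j)) n) (oblong≡ j) ⟩
  eTerm 0 j n                                     ∎
  where
  open ≡-Reasoning
  μs = strictPartitions (suc j) (suc (n ∸ oblong j)) (n ∸ oblong j)
  μs-sound = strictPartitions-sound (suc j) (suc (n ∸ oblong j)) (n ∸ oblong j)
... | no oblong≰n = sym (shift-below (j ℕ.* j ℕ.+ 1 ℕ.* j) (qPoch∞ (suc j))
                          (ℕ.<-≤-trans (ℕ.≰⇒> oblong≰n) (ℕ.≤-reflexive (oblong≡ j))))

∑ₗ-weight-c4Partitions : ∀ n → ∑ₗ weight (c4Partitions n) ≡ E 0 n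
∑ₗ-weight-c4Partitions n = below (suc n)
  where
  below : ∀ J → ∑ₗ weight (blocksBelow n J) ≡ ∑[ j < J ] eTerm 0 j n
  below zero = refl
  below (suc J) = trans (∑ₗ-++ weight (blocksBelow n J)) (cong₂ _+_ (below J) (∑ₗ-weight-block n J))

Unique-resp-↭ : ∀ {A : Set} {xs ys : List A} → xs ↭ ys → Unique xs → Unique ys
Unique-resp-↭ {A} xs↭ys = PermutationSetoid.Unique-resp-↭ (≡.setoid A) (↭⇒↭ₛ xs↭ys)

unique-sameMembers⇒↭ : ∀ {A : Set} {xs ys : List A} → Unique xs → Unique ys →
  (∀ {z} → z ∈ xs → z ∈ ys) → (∀ {z} → z ∈ ys → z ∈ xs) → xs ↭ ys
unique-sameMembers⇒↭ {xs = []} {[]} _ _ _ _ = ↭.refl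
unique-sameMembers⇒↭ {xs = []} {y ∷ ys} _ _ _ ys⊆xs with () ← ys⊆xs (here refl)
unique-sameMembers⇒↭ {xs = x ∷ xs} {ys} (x∉xs ∷ xs-unique) ys-unique xs⊆ys ys⊆xs
  with ys₁ , ys₂ , refl ← ∈-∃++ (xs⊆ys (here refl))
  with x∉rest ∷ rest-unique ← Unique-resp-↭ (↭.shift x ys₁ ys₂) ys-unique
  = ↭.trans (↭.prep x (unique-sameMembers⇒↭ xs-unique rest-unique xs⊆rest rest⊆xs)) (↭.↭-sym (↭.shift x ys₁ ys₂))
  where
  xs⊆rest : ∀ {z} → z ∈ xs → z ∈ ys₁ ++ ys₂
  xs⊆rest z∈xs with ↭.∈-resp-↭ (↭.shift x ys₁ ys₂) (xs⊆ys (there z∈xs))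
  ... | here refl = ⊥-elim (All.lookup x∉xs z∈xs refl)
  ... | there z∈rest = z∈rest
  rest⊆xs : ∀ {z} → z ∈ ys₁ ++ ys₂ → z ∈ xs
  rest⊆xs z∈rest with ys⊆xs (↭.∈-resp-↭ (↭.↭-sym (↭.shift x ys₁ ys₂)) (there z∈rest))
  ... | here refl = ⊥-elim (All.lookup x∉rest z∈rest refl)
  ... | there z∈xs = z∈xs

signedCount≡∑ₗweight : ∀ L → signedCount L ≡ ∑ₗ weight L
signedCount≡∑ₗweight [] = refl
signedCount≡∑ₗweight (p ∷ L) = cong (_+_ (weight p)) (signedCount≡∑ₗweight L)

signedCount≡E₀ : ∀ n L → Unique L → (∀ p → (p ∈ L) ⇔ (IsPartitionOf n p × C4 p)) → signedCount L ≡ E 0 n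
signedCount≡E₀ n L L-unique L-enumerates = begin
  signedCount L              ≡⟨ signedCount≡∑ₗweight L ⟩
  ∑ₗ weight L                ≡⟨ ∑ₗ-↭ weight L↭c4Partitions ⟩
  ∑ₗ weight (c4Partitions n) ≡⟨ ∑ₗ-weight-c4Partitions n ⟩
  E 0 n                      ∎
  where
  open ≡-Reasoning
  L↭c4Partitions : L ↭ c4Partitions n
  L↭c4Partitions = unique-sameMembers⇒↭ L-unique (blocksBelow-unique n (suc n))
    (λ p∈L → c4Partitions-complete n (Equivalence.to (L-enumerates _) p∈L))
    (λ p∈c4 → Equivalence.from (L-enumerates _) (c4Partitions-sound n p∈c4))

mainTheorem5 : (n : ℕ) (L : List (List ℕ)) →
    Unique L →
    (∀ p → (p ∈ L) ⇔ (IsPartitionOf n p × C4 p)) →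
    (∀ (j : ℤ) → + 2 * + n ≡ + 5 * j * j + + 3 * j → signedCount L ≡ negOnePow j)
    × ((∀ (j : ℤ) → + 2 * + n ≢ + 5 * j * j + + 3 * j) → signedCount L ≡ + 0)
mainTheorem5 n L L-unique L-enumerates =
  Product.map (λ at j 2n≡ → trans signedCount≡A₀ (at j 2n≡)) (λ elsewhere 2n≢ → trans signedCount≡A₀ (elsewhere 2n≢))
              (A₀-closed-form n)
  where
  signedCount≡A₀ : signedCount L ≡ A 0 n
  signedCount≡A₀ = trans (signedCount≡E₀ n L L-unique L-enumerates) (E≗A 0 n)
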